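{- Let $C(x)$ and $D(x)$ be the Thue–Morse and period-doubling continued fractions. Then the sequences of Hankel determinants $(H_n(C(x)))_{n\ge0}$ and $(H_n(D(x)))_{n\ge0}$ are $2$-automatic.
   Context: Thue–Morse sequence: $t_0=1$, $t_{2n}=t_n$ ($n\ge1$), $t_{2n+1}=-t_n$. Period-doubling sequence: $s_{2n}=1$, $s_{2n+1}=-s_n$. For a sequence $(a_n)$, the Stieltjes continued fraction $a_0/(1+a_1x/(1+a_2x/(1+\cdots)))\in\mathbb{Z}[[x]]$ is the $x$-adic limit of its finite truncations. $C(x)$ is this with $a_n=t_n$, $D(x)$ with $a_n=s_n$. For $f(x)=\sum a_nx^n$, the Hankel determinant is $H_n(f)=\det(a_{i+j})_{0\le i,j\le n-1}$ for $n\ge1$ and $H_0(f)=1$. A sequence $(u_n)$ is $2$-automatic if the set $\{(u_{2^dn+r})_{n\ge0}: d\ge0,\ 0\le r<2^d\}$ is finite. -}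

module Defs where

open import Data.Nat using (ℕ; zero; suc; _<_; _^_; _≤_)
import Data.Nat as ℕ
open import Data.Integer using (ℤ; +_; -_; _+_; _*_)
open import Data.Fin using (Fin; toℕ; punchIn)
import Data.Fin as Fin
open import Data.List using (List; []; _∷_)
open import Data.List.Relation.Unary.Any using (Any)
open import Data.Product using (∃; _×_)
open import Relation.Binary.PropositionalEquality using (_≡_)

Series : Set
Series = ℕ → ℤ

IsThueMorse : (ℕ → ℤ) → Set
IsThueMorse t =
  (t 0 ≡ + 1) ×
  (∀ n → 1 ≤ n → t (2 ℕ.* n) ≡ t n) ×
  (∀ n → t (2 ℕ.* n ℕ.+ 1) ≡ - t n)

IsPeriodDoubling : (ℕ → ℤ) → Set
IsPeriodDoubling s =
  (∀ n → s (2 ℕ.* n) ≡ + 1) ×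
  (∀ n → s (2 ℕ.* n ℕ.+ 1) ≡ - s n)

-- Power series 1/(1 + x g) over ℤ.
-- q₀ = 1, q_{n+1} = - Σ_{j=0}^{n} g_j q_{n-j}.

dot : Series → List ℤ → ℤ
dot g []       = + 0
dot g (r ∷ rs) = g 0 * r + dot (λ j → g (suc j)) rs

-- invRev g n = [q_n, q_{n-1}, …, q_0]
invRev : Series → ℕ → List ℤ
invRev g zero    = + 1 ∷ []
invRev g (suc n) = (- dot g (invRev g n)) ∷ invRev g n

headℤ : List ℤ → ℤ
headℤ []      = + 0
headℤ (x ∷ _) = x

invOnePlusX : Series → Series
invOnePlusX g n = headℤ (invRev g n)

constSeries : ℤ → Series
constSeries c zero    = c
constSeries c (suc _) = + 0

-- cfTail a d k = a_k/(1 + a_{k+1}x/(1 + ⋯ /(1 + a_{k+d}x)))   (as a power series)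
cfTail : (ℕ → ℤ) → ℕ → ℕ → Series
cfTail a zero    k = constSeries (a k)
cfTail a (suc d) k = λ n → a k * invOnePlusX (cfTail a d (suc k)) n

cfTrunc : (ℕ → ℤ) → ℕ → Series
cfTrunc a N = cfTail a N 0

IsStieltjesCF : (ℕ → ℤ) → Series → Set
IsStieltjesCF a f = ∀ n → ∃ λ N → ∀ M → N ≤ M → cfTrunc a M n ≡ f n

sign : ℕ → ℤ
sign zero          = + 1
sign (suc zero)    = - (+ 1)
sign (suc (suc n)) = sign n

sumFin : (n : ℕ) → (Fin n → ℤ) → ℤ
sumFin zero    f = + 0
sumFin (suc n) f = f Fin.zero + sumFin n (λ i → f (Fin.suc i))

det : (n : ℕ) → (Fin n → Fin n → ℤ) → ℤ
det zero    M = + 1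
det (suc n) M =
  sumFin (suc n) λ j → sign (toℕ j) * M Fin.zero j * det n (λ i k → M (Fin.suc i) (punchIn j k))

hankel : Series → ℕ → ℤ
hankel f n = det n (λ i j → f (toℕ i ℕ.+ toℕ j))

-- 2-automatic: the 2-kernel {(u_{2^d n + r})_n : d ≥ 0, 0 ≤ r < 2^d} is finite,
-- i.e. covered (up to equality of sequences, taken pointwise) by a finite list.

Is2Automatic : (ℕ → ℤ) → Set
Is2Automatic u =
  ∃ λ (L : List (ℕ → ℤ)) →
    ∀ d r → r < 2 ^ d → Any (λ v → ∀ n → u (2 ^ d ℕ.* n ℕ.+ r) ≡ v n) L

-- For a ±1 sequence a let f_k = a_k/(1 + a_{k+1}x/(1 + ⋯)), so that f_k (1 + x f_{k+1}) = a_k.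
-- Multiplying the Hankel matrix of f_k on the right by the unit upper triangular Toeplitz matrix
-- of 1 + x f_{k+1} leaves first row (a_k, 0, …, 0) and, below it, −a_k times a lower unitriangular
-- matrix times the shifted Hankel matrix of f_{k+1}; the same step applied to that matrix brings
-- in f_{k+2}.  Carrying the lower unitriangular left factor along instead of eliminating it gives
-- H_{n+1}(f_k) = a_k (a_k a_{k+1})^n H_n(f_{k+2}), i.e. H_{n+1} = H_n a_0 a_1 ⋯ a_{2n}.
-- For Thue–Morse this yields H_{2m} = 1 and H_{2m+1} = t_m; for period doubling H_{2m} = (−1)^m
-- and H_{2m+1} = s_0 ⋯ s_{m−1}.  In both cases finitely many sequences, closed under
-- n ↦ 2n and n ↦ 2n + 1, contain the Hankel sequence.

module Submission where

open import Defs
open import Data.Nat as ℕ using (ℕ; zero; suc; z≤n; s≤s; _<_; _≤_; _∸_; _⊔_)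
import Data.Nat.Properties as ℕₚ
open import Data.Nat.Induction using (<-rec)
import Data.Nat.Tactic.RingSolver as ℕ-Ring
open import Data.Integer using (ℤ; +_; -_; -1ℤ; _+_; _*_; _^_)
import Data.Integer.Properties as ℤₚ
open import Data.Integer.Tactic.RingSolver using (solve-∀)
open import Data.Fin as Fin using (Fin; toℕ; punchIn)
import Data.Fin.Properties as Finₚ
open import Data.List as List using (List; []; _∷_)
open import Data.List.Membership.Propositional using (_∈_)
import Data.List.Relation.Unary.Any as Any
import Data.List.Relation.Unary.Any.Properties as Anyₚ
open import Data.Product using (∃; _×_; _,_; proj₁; proj₂)
open import Data.Sum using (_⊎_; inj₁; inj₂)
open import Data.Empty using (⊥-elim)
open import Relation.Nullary using (¬_; Dec; yes; no)
open import Relation.Binary using (tri<; tri≈; tri>)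
open import Relation.Binary.PropositionalEquality
open import Function using (_∘_)

-- Finite sums

∑ : ℕ → (ℕ → ℤ) → ℤ
∑ zero    f = + 0
∑ (suc n) f = f 0 + ∑ n (λ k → f (suc k))

∑-cong : ∀ n {f g : ℕ → ℤ} → (∀ k → k < n → f k ≡ g k) → ∑ n f ≡ ∑ n g
∑-cong zero    f≡g = refl
∑-cong (suc n) f≡g = cong₂ _+_ (f≡g 0 (s≤s z≤n)) (∑-cong n (λ k k<n → f≡g (suc k) (s≤s k<n)))

∑-zeros : ∀ n {f : ℕ → ℤ} → (∀ k → k < n → f k ≡ + 0) → ∑ n f ≡ + 0
∑-zeros zero    f≡0 = refl
∑-zeros (suc n) f≡0
  rewrite f≡0 0 (s≤s z≤n) | ∑-zeros n (λ k k<n → f≡0 (suc k) (s≤s k<n)) = refl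

∑-linear : ∀ n (c : ℤ) {f g h : ℕ → ℤ} → (∀ k → k < n → h k ≡ c * f k + g k) →
           ∑ n h ≡ c * ∑ n f + ∑ n g
∑-linear zero    c h≡ = sym (trans (ℤₚ.+-identityʳ _) (ℤₚ.*-zeroʳ c))
∑-linear (suc n) c {f} {g} h≡
  rewrite h≡ 0 (s≤s z≤n) | ∑-linear n c {λ k → f (suc k)} {λ k → g (suc k)} (λ k k<n → h≡ (suc k) (s≤s k<n))
  = rearrange c (f 0) (g 0) (∑ n (λ k → f (suc k))) (∑ n (λ k → g (suc k)))
  where
  rearrange : ∀ c a b s t → c * a + b + (c * s + t) ≡ c * (a + s) + (b + t)
  rearrange = solve-∀

∑-scaleˡ : ∀ n (c : ℤ) (f : ℕ → ℤ) → ∑ n (λ k → c * f k) ≡ c * ∑ n f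
∑-scaleˡ n c f = begin
  ∑ n (λ k → c * f k)         ≡⟨ ∑-linear n c (λ k _ → sym (ℤₚ.+-identityʳ _)) ⟩
  c * ∑ n f + ∑ n (λ _ → + 0) ≡⟨ cong (λ x → c * ∑ n f + x) (∑-zeros n (λ _ _ → refl)) ⟩
  c * ∑ n f + + 0             ≡⟨ ℤₚ.+-identityʳ _ ⟩
  c * ∑ n f                   ∎
  where open ≡-Reasoning

∑-scaleʳ : ∀ n (f : ℕ → ℤ) c → ∑ n f * c ≡ ∑ n (λ k → f k * c)
∑-scaleʳ n f c = trans (ℤₚ.*-comm (∑ n f) c)
  (trans (sym (∑-scaleˡ n c f)) (∑-cong n (λ k _ → ℤₚ.*-comm c (f k))))

∑-+ : ∀ n (f g : ℕ → ℤ) → ∑ n (λ k → f k + g k) ≡ ∑ n f + ∑ n g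
∑-+ n f g = trans (∑-linear n (+ 1) (λ k _ → cong (_+ g k) (sym (ℤₚ.*-identityˡ (f k)))))
                  (cong (_+ ∑ n g) (ℤₚ.*-identityˡ (∑ n f)))

∑-last : ∀ n (f : ℕ → ℤ) → ∑ (suc n) f ≡ ∑ n f + f n
∑-last zero    f = trans (ℤₚ.+-identityʳ (f 0)) (sym (ℤₚ.+-identityˡ (f 0)))
∑-last (suc n) f rewrite ∑-last n (λ k → f (suc k)) = sym (ℤₚ.+-assoc (f 0) _ _)

∑-split : ∀ m n (f : ℕ → ℤ) → ∑ (m ℕ.+ n) f ≡ ∑ m f + ∑ n (λ k → f (m ℕ.+ k))
∑-split zero    n f = sym (ℤₚ.+-identityˡ _)
∑-split (suc m) n f rewrite ∑-split m n (λ k → f (suc k)) = sym (ℤₚ.+-assoc (f 0) _ _)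

∑-truncate : ∀ m n (f : ℕ → ℤ) → m ≤ n → (∀ k → m ≤ k → k < n → f k ≡ + 0) → ∑ n f ≡ ∑ m f
∑-truncate m n f m≤n tail≡0 with ℕₚ.m≤n⇒∃[o]m+o≡n m≤n
... | d , refl = begin
  ∑ (m ℕ.+ d) f                       ≡⟨ ∑-split m d f ⟩
  ∑ m f + ∑ d (λ k → f (m ℕ.+ k))     ≡⟨ cong (λ x → ∑ m f + x) (∑-zeros d (λ k k<d →
                                           tail≡0 (m ℕ.+ k) (ℕₚ.m≤m+n m k) (ℕₚ.+-monoʳ-< m k<d))) ⟩
  ∑ m f + + 0                         ≡⟨ ℤₚ.+-identityʳ _ ⟩
  ∑ m f                               ∎
  where open ≡-Reasoning

∑-comm : ∀ m n (f : ℕ → ℕ → ℤ) → ∑ m (λ i → ∑ n (f i)) ≡ ∑ n (λ j → ∑ m (λ i → f i j))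
∑-comm zero    n f = sym (∑-zeros n (λ _ _ → refl))
∑-comm (suc m) n f rewrite ∑-comm m n (λ i → f (suc i)) = sym (∑-+ n (f 0) _)

∑-single : ∀ n t (f : ℕ → ℤ) → t < n → (∀ k → k < n → k ≢ t → f k ≡ + 0) → ∑ n f ≡ f t
∑-single (suc n) zero f _ others≡0 =
  trans (cong (λ x → f 0 + x) (∑-zeros n (λ k k<n → others≡0 (suc k) (s≤s k<n) (λ ()))))
        (ℤₚ.+-identityʳ _)
∑-single (suc n) (suc t) f (s≤s t<n) others≡0 =
  trans (cong (_+ ∑ n (λ k → f (suc k))) (others≡0 0 (s≤s z≤n) (λ ())))
  (trans (ℤₚ.+-identityˡ _)
         (∑-single n t (λ k → f (suc k)) t<n
           (λ k k<n k≢t → others≡0 (suc k) (s≤s k<n) (k≢t ∘ ℕₚ.suc-injective))))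

∑-reverse : ∀ n (f : ℕ → ℕ → ℤ) → ∑ (suc n) (λ m → f m (n ∸ m)) ≡ ∑ (suc n) (λ k → f (n ∸ k) k)
∑-reverse zero    f = refl
∑-reverse (suc n) f = begin
  f 0 (suc n) + ∑ (suc n) (λ m → f (suc m) (n ∸ m))   ≡⟨ cong (λ x → f 0 (suc n) + x) (∑-reverse n (λ m → f (suc m))) ⟩
  f 0 (suc n) + ∑ (suc n) (λ k → f (suc (n ∸ k)) k)   ≡⟨ ℤₚ.+-comm (f 0 (suc n)) _ ⟩
  ∑ (suc n) (λ k → f (suc (n ∸ k)) k) + f 0 (suc n)   ≡⟨ cong₂ _+_
     (∑-cong (suc n) (λ k k≤n → cong (λ x → f x k) (sym (ℕₚ.+-∸-assoc 1 (ℕₚ.≤-pred k≤n)))))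
     (cong (λ x → f x (suc n)) (sym (ℕₚ.n∸n≡0 n))) ⟩
  ∑ (suc n) (λ k → f (suc n ∸ k) k) + f (suc n ∸ suc n) (suc n)
                                                      ≡⟨ ∑-last (suc n) (λ k → f (suc n ∸ k) k) ⟨
  ∑ (suc (suc n)) (λ k → f (suc n ∸ k) k)             ∎
  where open ≡-Reasoning

∑-cancelling-pair : ∀ n p (f : ℕ → ℤ) → suc p < n →
  (∀ k → k < n → k ≢ p → k ≢ suc p → f k ≡ + 0) → f p + f (suc p) ≡ + 0 → ∑ n f ≡ + 0
∑-cancelling-pair (suc (suc n)) zero f _ others≡0 pair≡0 = begin
  f 0 + (f 1 + ∑ n (λ k → f (suc (suc k))))   ≡⟨ ℤₚ.+-assoc (f 0) (f 1) _ ⟨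
  f 0 + f 1 + ∑ n (λ k → f (suc (suc k)))     ≡⟨ cong₂ _+_ pair≡0
                                                   (∑-zeros n (λ k k<n → others≡0 (suc (suc k)) (s≤s (s≤s k<n)) (λ ()) (λ ()))) ⟩
  + 0                                         ∎
  where open ≡-Reasoning
∑-cancelling-pair (suc n) (suc p) f (s≤s sp<n) others≡0 pair≡0 =
  trans (cong (_+ ∑ n (f ∘ suc)) (others≡0 0 (s≤s z≤n) (λ ()) (λ ())))
  (trans (ℤₚ.+-identityˡ _)
    (∑-cancelling-pair n p (f ∘ suc) sp<n
      (λ k k<n k≢p k≢sp → others≡0 (suc k) (s≤s k<n) (k≢p ∘ ℕₚ.suc-injective) (k≢sp ∘ ℕₚ.suc-injective))
      pair≡0))

-- Determinants

Matrix : Set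
Matrix = ℕ → ℕ → ℤ

-- Matrices are total; detℕ n reads only the leading n × n block.
detℕ : ℕ → Matrix → ℤ
detℕ n M = det n (λ i j → M (toℕ i) (toℕ j))

sumFin-cong : ∀ n {f g : Fin n → ℤ} → (∀ j → f j ≡ g j) → sumFin n f ≡ sumFin n g
sumFin-cong zero    f≡g = refl
sumFin-cong (suc n) f≡g = cong₂ _+_ (f≡g Fin.zero) (sumFin-cong n (f≡g ∘ Fin.suc))

sumFin-toℕ : ∀ n (g : ℕ → ℤ) → sumFin n (g ∘ toℕ) ≡ ∑ n g
sumFin-toℕ zero    g = refl
sumFin-toℕ (suc n) g = cong (λ x → g 0 + x) (sumFin-toℕ n (g ∘ suc))

det-cong : ∀ n {A B : Fin n → Fin n → ℤ} → (∀ i j → A i j ≡ B i j) → det n A ≡ det n B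
det-cong zero    A≡B = refl
det-cong (suc n) A≡B = sumFin-cong (suc n) λ j →
  cong₂ _*_ (cong (sign (toℕ j) *_) (A≡B Fin.zero j)) (det-cong n (λ i k → A≡B (Fin.suc i) (punchIn j k)))

detℕ-cong : ∀ n {A B : Matrix} → (∀ i j → i < n → j < n → A i j ≡ B i j) → detℕ n A ≡ detℕ n B
detℕ-cong n A≡B = det-cong n (λ i j → A≡B (toℕ i) (toℕ j) (Finₚ.toℕ<n i) (Finₚ.toℕ<n j))

punchInℕ : ℕ → ℕ → ℕ
punchInℕ zero    k       = suc k
punchInℕ (suc j) zero    = zero
punchInℕ (suc j) (suc k) = suc (punchInℕ j k)

toℕ-punchIn : ∀ {n} (j : Fin (suc n)) (k : Fin n) → toℕ (punchIn j k) ≡ punchInℕ (toℕ j) (toℕ k)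
toℕ-punchIn Fin.zero    k           = refl
toℕ-punchIn (Fin.suc j) Fin.zero    = refl
toℕ-punchIn (Fin.suc j) (Fin.suc k) = cong suc (toℕ-punchIn j k)

punchInℕ-< : ∀ j k → k < j → punchInℕ j k ≡ k
punchInℕ-< (suc j) zero    _       = refl
punchInℕ-< (suc j) (suc k) (s≤s k<j) = cong suc (punchInℕ-< j k k<j)

punchInℕ-≥ : ∀ j k → j ≤ k → punchInℕ j k ≡ suc k
punchInℕ-≥ zero    k       _       = refl
punchInℕ-≥ (suc j) (suc k) (s≤s j≤k) = cong suc (punchInℕ-≥ j k j≤k)

punchInℕ≢ : ∀ j k → punchInℕ j k ≢ j
punchInℕ≢ zero    k       ()
punchInℕ≢ (suc j) zero    ()
punchInℕ≢ (suc j) (suc k) eq = punchInℕ≢ j k (ℕₚ.suc-injective eq)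

punchInℕ-injective : ∀ j k k′ → punchInℕ j k ≡ punchInℕ j k′ → k ≡ k′
punchInℕ-injective zero    k       k′       eq = ℕₚ.suc-injective eq
punchInℕ-injective (suc j) zero    zero     _  = refl
punchInℕ-injective (suc j) (suc k) (suc k′) eq = cong suc (punchInℕ-injective j k k′ (ℕₚ.suc-injective eq))

punchInℕ-surjective : ∀ {n} j c → j < suc n → c < suc n → c ≢ j →
                      ∃ λ c′ → c′ < n × punchInℕ j c′ ≡ c
punchInℕ-surjective         zero    zero    _ _         c≢j = ⊥-elim (c≢j refl)
punchInℕ-surjective         zero    (suc c) _ (s≤s c<n) _   = c , c<n , refl
punchInℕ-surjective {zero}  (suc j) _       (s≤s ()) _ _
punchInℕ-surjective {suc n} (suc j) zero    _ _ _ = zero , s≤s z≤n , refl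
punchInℕ-surjective {suc n} (suc j) (suc c) (s≤s j<) (s≤s c<) c≢j
  with punchInℕ-surjective j c j< c< (c≢j ∘ cong suc)
... | c′ , c′<n , eq = suc c′ , s≤s c′<n , cong suc eq

punchInℕ-suc : ∀ p k → k ≢ p → punchInℕ p k ≡ punchInℕ (suc p) k
punchInℕ-suc zero    zero    k≢p = ⊥-elim (k≢p refl)
punchInℕ-suc zero    (suc k) _   = refl
punchInℕ-suc (suc p) zero    _   = refl
punchInℕ-suc (suc p) (suc k) k≢p = cong suc (punchInℕ-suc p k (k≢p ∘ cong suc))

minor : Matrix → ℕ → Matrix
minor M j i k = M (suc i) (punchInℕ j k)

laplaceTerm : ℕ → Matrix → ℕ → ℤ
laplaceTerm n M j = sign j * M 0 j * detℕ n (minor M j)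

detℕ-expand : ∀ n M → detℕ (suc n) M ≡ ∑ (suc n) (laplaceTerm n M)
detℕ-expand n M = trans
  (sumFin-cong (suc n) λ j → cong (sign (toℕ j) * M 0 (toℕ j) *_)
    (det-cong n (λ i k → cong (M (suc (toℕ i))) (toℕ-punchIn j k))))
  (sumFin-toℕ (suc n) (laplaceTerm n M))

detℕ-linear : ∀ n c (s : ℤ) (A B C : Matrix) → c < n →
  (∀ i j → j ≢ c → B i j ≡ A i j) → (∀ i j → j ≢ c → C i j ≡ A i j) →
  (∀ i → C i c ≡ s * A i c + B i c) → detℕ n C ≡ s * detℕ n A + detℕ n B
detℕ-linear (suc m) c s A B C c<n B≡A C≡A C-col = begin
  detℕ (suc m) C                                                ≡⟨ detℕ-expand m C ⟩
  ∑ (suc m) (laplaceTerm m C)                                   ≡⟨ ∑-linear (suc m) s termwise ⟩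
  s * ∑ (suc m) (laplaceTerm m A) + ∑ (suc m) (laplaceTerm m B) ≡⟨ cong₂ (λ x y → s * x + y)
                                                                     (detℕ-expand m A) (detℕ-expand m B) ⟨
  s * detℕ (suc m) A + detℕ (suc m) B                           ∎
  where
  open ≡-Reasoning
  minor-c : ∀ X → (∀ i j → j ≢ c → X i j ≡ A i j) → detℕ m (minor X c) ≡ detℕ m (minor A c)
  minor-c X X≡A = detℕ-cong m (λ i k _ _ → X≡A (suc i) (punchInℕ c k) (punchInℕ≢ c k))
  termwise : ∀ j → j < suc m → laplaceTerm m C j ≡ s * laplaceTerm m A j + laplaceTerm m B j
  termwise j j<n with j ℕ.≟ c
  ... | yes refl = begin
    sign j * C 0 j * detℕ m (minor C j)                 ≡⟨ cong₂ (λ x y → sign j * x * y) (C-col 0) (minor-c C C≡A) ⟩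
    sign j * (s * A 0 j + B 0 j) * detℕ m (minor A j)   ≡⟨ distrib (sign j) s (A 0 j) (B 0 j) _ ⟩
    s * laplaceTerm m A j + sign j * B 0 j * detℕ m (minor A j)
                                                        ≡⟨ cong (λ x → s * laplaceTerm m A j + sign j * B 0 j * x)
                                                             (minor-c B B≡A) ⟨
    s * laplaceTerm m A j + laplaceTerm m B j           ∎
    where distrib : ∀ g s a b d → g * (s * a + b) * d ≡ s * (g * a * d) + g * b * d
          distrib = solve-∀
  ... | no j≢c with punchInℕ-surjective j c j<n c<n (j≢c ∘ sym)
  ...   | c′ , c′<m , c′↦c = begin
    sign j * C 0 j * detℕ m (minor C j)                 ≡⟨ cong₂ (λ x y → sign j * x * y) (C≡A 0 j j≢c) minor-linear ⟩
    sign j * A 0 j * (s * detℕ m (minor A j) + detℕ m (minor B j))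
                                                        ≡⟨ distrib (sign j) (A 0 j) s _ _ ⟩
    s * laplaceTerm m A j + sign j * A 0 j * detℕ m (minor B j)
                                                        ≡⟨ cong (λ x → s * laplaceTerm m A j + sign j * x * detℕ m (minor B j))
                                                             (B≡A 0 j j≢c) ⟨
    s * laplaceTerm m A j + laplaceTerm m B j           ∎
    where
    distrib : ∀ g a s x y → g * a * (s * x + y) ≡ s * (g * a * x) + g * a * y
    distrib = solve-∀
    avoids-c : ∀ k → k ≢ c′ → punchInℕ j k ≢ c
    avoids-c k k≢c′ eq = k≢c′ (punchInℕ-injective j k c′ (trans eq (sym c′↦c)))
    minor-linear : detℕ m (minor C j) ≡ s * detℕ m (minor A j) + detℕ m (minor B j)
    minor-linear = detℕ-linear m c′ s (minor A j) (minor B j) (minor C j) c′<m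
      (λ i k k≢c′ → B≡A (suc i) (punchInℕ j k) (avoids-c k k≢c′))
      (λ i k k≢c′ → C≡A (suc i) (punchInℕ j k) (avoids-c k k≢c′))
      (λ i → subst (λ x → C (suc i) x ≡ s * A (suc i) x + B (suc i) x) (sym c′↦c) (C-col (suc i)))

sign-suc : ∀ j → sign (suc j) ≡ - sign j
sign-suc zero          = refl
sign-suc (suc zero)    = refl
sign-suc (suc (suc j)) = sign-suc j

punchInℕ-adjacent : ∀ m j p → j ≢ p → j ≢ suc p → suc p < suc m → j < suc m →
  ∃ λ p′ → punchInℕ j p′ ≡ p × punchInℕ j (suc p′) ≡ suc p × suc p′ < m
punchInℕ-adjacent m j p j≢p j≢sp sp<n j<n with ℕₚ.<-cmp j p
... | tri≈ _ j≡p _ = ⊥-elim (j≢p j≡p)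
punchInℕ-adjacent m j (suc p) _ _ sp<n _ | tri< (s≤s j≤p) _ _ =
  p , punchInℕ-≥ j p j≤p , punchInℕ-≥ j (suc p) (ℕₚ.m≤n⇒m≤1+n j≤p) , ℕₚ.≤-pred sp<n
... | tri> _ _ p<j = p , punchInℕ-< j p p<j , punchInℕ-< j (suc p) sp<j , ℕₚ.<-≤-trans sp<j (ℕₚ.≤-pred j<n)
  where sp<j = ℕₚ.≤∧≢⇒< p<j (j≢sp ∘ sym)

detℕ-adjacent-equal : ∀ n p (A : Matrix) → suc p < n → (∀ i → A i p ≡ A i (suc p)) → detℕ n A ≡ + 0
detℕ-adjacent-equal (suc m) p A sp<n cols≡ =
  trans (detℕ-expand m A) (∑-cancelling-pair (suc m) p (laplaceTerm m A) sp<n others≡0 pair≡0)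
  where
  others≡0 : ∀ j → j < suc m → j ≢ p → j ≢ suc p → laplaceTerm m A j ≡ + 0
  others≡0 j j<n j≢p j≢sp with punchInℕ-adjacent m j p j≢p j≢sp sp<n j<n
  ... | p′ , ↦p , ↦sp , sp′<m = trans
    (cong (sign j * A 0 j *_) (detℕ-adjacent-equal m p′ (minor A j) sp′<m
      (λ i → trans (cong (A (suc i)) ↦p) (trans (cols≡ (suc i)) (cong (A (suc i)) (sym ↦sp))))))
    (ℤₚ.*-zeroʳ (sign j * A 0 j))
  same-minor : ∀ i k → minor A (suc p) i k ≡ minor A p i k
  same-minor i k with k ℕ.≟ p
  ... | no k≢p  = cong (A (suc i)) (sym (punchInℕ-suc p k k≢p))
  ... | yes refl = begin
    A (suc i) (punchInℕ (suc k) k) ≡⟨ cong (A (suc i)) (punchInℕ-< (suc k) k (ℕₚ.n<1+n k)) ⟩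
    A (suc i) k                    ≡⟨ cols≡ (suc i) ⟩
    A (suc i) (suc k)              ≡⟨ cong (A (suc i)) (punchInℕ-≥ k k ℕₚ.≤-refl) ⟨
    A (suc i) (punchInℕ k k)       ∎
    where open ≡-Reasoning
  pair≡0 : laplaceTerm m A p + laplaceTerm m A (suc p) ≡ + 0
  pair≡0 = begin
    laplaceTerm m A p + sign (suc p) * A 0 (suc p) * detℕ m (minor A (suc p))
      ≡⟨ cong (λ x → laplaceTerm m A p + x)
           (cong₂ _*_ (cong₂ _*_ (sign-suc p) (sym (cols≡ 0))) (detℕ-cong m (λ i k _ _ → same-minor i k))) ⟩
    sign p * A 0 p * D + (- sign p) * A 0 p * D
      ≡⟨ cancel (sign p) (A 0 p) D ⟩
    + 0 ∎
    where
    open ≡-Reasoning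
    D = detℕ m (minor A p)
    cancel : ∀ g x d → g * x * d + (- g) * x * d ≡ + 0
    cancel = solve-∀

column : Matrix → ℕ → ℕ → ℤ
column A c i = A i c

setColumn : Matrix → ℕ → (ℕ → ℤ) → Matrix
setColumn A c v i j with j ℕ.≟ c
... | yes _ = v i
... | no  _ = A i j

setColumn-≡ : ∀ A c v i → setColumn A c v i c ≡ v i
setColumn-≡ A c v i with c ℕ.≟ c
... | yes _   = refl
... | no  c≢c = ⊥-elim (c≢c refl)

setColumn-≢ : ∀ A c v i j → j ≢ c → setColumn A c v i j ≡ A i j
setColumn-≢ A c v i j j≢c with j ℕ.≟ c
... | yes j≡c = ⊥-elim (j≢c j≡c)
... | no  _   = refl

setColumn-self : ∀ A c i j → setColumn A c (column A c) i j ≡ A i j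
setColumn-self A c i j with j ℕ.≟ c
... | yes refl = refl
... | no  _    = refl

setColumn-comm : ∀ A p q x y → p ≢ q → ∀ i j →
  setColumn (setColumn A p x) q y i j ≡ setColumn (setColumn A q y) p x i j
setColumn-comm A p q x y p≢q i j = by-cases j (j ℕ.≟ p) (j ℕ.≟ q)
  where
  by-cases : ∀ j → Dec (j ≡ p) → Dec (j ≡ q) →
    setColumn (setColumn A p x) q y i j ≡ setColumn (setColumn A q y) p x i j
  by-cases _ (yes refl) (yes p≡q) = ⊥-elim (p≢q p≡q)
  by-cases _ (yes refl) (no p≢q′) =
    trans (setColumn-≢ _ q y i p p≢q′) (trans (setColumn-≡ A p x i) (sym (setColumn-≡ _ p x i)))
  by-cases _ (no q≢p) (yes refl) =
    trans (setColumn-≡ _ q y i) (sym (trans (setColumn-≢ _ p x i q q≢p) (setColumn-≡ A q y i)))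
  by-cases j (no j≢p) (no j≢q) =
    trans (setColumn-≢ _ q y i j j≢q) (trans (setColumn-≢ A p x i j j≢p)
      (sym (trans (setColumn-≢ _ p x i j j≢p) (setColumn-≢ A q y i j j≢q))))

detℕ-setColumn-linear : ∀ n c s A (x y : ℕ → ℤ) → c < n →
  detℕ n (setColumn A c (λ i → s * x i + y i)) ≡ s * detℕ n (setColumn A c x) + detℕ n (setColumn A c y)
detℕ-setColumn-linear n c s A x y c<n = detℕ-linear n c s (setColumn A c x) (setColumn A c y) _ c<n
  (λ i j j≢c → trans (setColumn-≢ A c y i j j≢c) (sym (setColumn-≢ A c x i j j≢c)))
  (λ i j j≢c → trans (setColumn-≢ A c _ i j j≢c) (sym (setColumn-≢ A c x i j j≢c)))
  (λ i → trans (setColumn-≡ A c _ i) (sym (cong₂ (λ a b → s * a + b) (setColumn-≡ A c x i) (setColumn-≡ A c y i))))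

-- Bilinearity in the two columns plus vanishing on equal columns gives antisymmetry.
detℕ-swap-adjacent : ∀ n p A (x y : ℕ → ℤ) → suc p < n →
  detℕ n (setColumn (setColumn A p x) (suc p) y) + detℕ n (setColumn (setColumn A p y) (suc p) x) ≡ + 0
detℕ-swap-adjacent n p A x y sp<n = begin
  D x y + D y x                                    ≡⟨ rearrange (D x x) (D x y) (D y x) (D y y) (D-diag x) (D-diag y) ⟩
  + 1 * (+ 1 * D x x + D x y) + (+ 1 * D y x + D y y) ≡⟨ cong₂ (λ a b → + 1 * a + b) (linear-right x) (linear-right y) ⟨
  + 1 * D x z + D y z                              ≡⟨ linear-left z ⟨
  D z z                                            ≡⟨ D-diag z ⟩
  + 0                                              ∎
  where
  open ≡-Reasoning
  D : (ℕ → ℤ) → (ℕ → ℤ) → ℤ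
  D u w = detℕ n (setColumn (setColumn A p u) (suc p) w)
  z : ℕ → ℤ
  z i = + 1 * x i + y i
  p≢sp : p ≢ suc p
  p≢sp = ℕₚ.<⇒≢ (ℕₚ.n<1+n p)
  D-diag : ∀ u → D u u ≡ + 0
  D-diag u = detℕ-adjacent-equal n p (setColumn (setColumn A p u) (suc p) u) sp<n λ i →
    trans (setColumn-≢ (setColumn A p u) (suc p) u i p p≢sp)
      (trans (setColumn-≡ A p u i) (sym (setColumn-≡ (setColumn A p u) (suc p) u i)))
  linear-right : ∀ u → D u z ≡ + 1 * D u x + D u y
  linear-right u = detℕ-setColumn-linear n (suc p) (+ 1) (setColumn A p u) x y sp<n
  swapped : ∀ u w → D u w ≡ detℕ n (setColumn (setColumn A (suc p) w) p u)
  swapped u w = detℕ-cong n (λ i j _ _ → setColumn-comm A p (suc p) u w p≢sp i j)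
  linear-left : ∀ w → D z w ≡ + 1 * D x w + D y w
  linear-left w = begin
    D z w                                        ≡⟨ swapped z w ⟩
    detℕ n (setColumn (setColumn A (suc p) w) p z) ≡⟨ detℕ-setColumn-linear n p (+ 1) _ x y (ℕₚ.<-trans (ℕₚ.n<1+n p) sp<n) ⟩
    + 1 * detℕ n (setColumn (setColumn A (suc p) w) p x) + detℕ n (setColumn (setColumn A (suc p) w) p y)
                                                 ≡⟨ cong₂ (λ a b → + 1 * a + b) (swapped x w) (swapped y w) ⟨
    + 1 * D x w + D y w                          ∎
  rearrange : ∀ a b c d → a ≡ + 0 → d ≡ + 0 → b + c ≡ + 1 * (+ 1 * a + b) + (+ 1 * c + d)
  rearrange a b c d refl refl = solve b c
    where solve : ∀ b c → b + c ≡ + 1 * (+ 1 * + 0 + b) + (+ 1 * c + + 0)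
          solve = solve-∀

detℕ-equal-columns : ∀ n p q A → p < q → q < n → (∀ i → A i p ≡ A i q) → detℕ n A ≡ + 0
detℕ-equal-columns n p (suc q) A (s≤s p≤q) sq<n cols≡ with p ℕ.≟ q
... | yes refl = detℕ-adjacent-equal n p A sq<n cols≡
... | no p≢q = begin
  detℕ n A                                        ≡⟨ detℕ-cong n (λ i j _ _ → unswap i j) ⟨
  detℕ n (S (column A q) (column A (suc q)))       ≡⟨ ℤₚ.+-identityʳ _ ⟨
  detℕ n (S (column A q) (column A (suc q))) + + 0 ≡⟨ cong (λ x → detℕ n (S (column A q) (column A (suc q))) + x) swapped≡0 ⟨
  detℕ n (S (column A q) (column A (suc q))) + detℕ n (S (column A (suc q)) (column A q))
                                                  ≡⟨ detℕ-swap-adjacent n q A _ _ sq<n ⟩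
  + 0                                             ∎
  where
  open ≡-Reasoning
  S : (ℕ → ℤ) → (ℕ → ℤ) → Matrix
  S x y = setColumn (setColumn A q x) (suc q) y
  unswap : ∀ i j → S (column A q) (column A (suc q)) i j ≡ A i j
  unswap i j with j ℕ.≟ suc q
  ... | yes refl = refl
  ... | no  _    = setColumn-self A q i j
  p<q : p < q
  p<q = ℕₚ.≤∧≢⇒< p≤q p≢q
  swapped≡0 : detℕ n (S (column A (suc q)) (column A q)) ≡ + 0
  swapped≡0 = detℕ-equal-columns n p q _ p<q (ℕₚ.<-trans (ℕₚ.n<1+n q) sq<n) λ i → begin
    S (column A (suc q)) (column A q) i p   ≡⟨ setColumn-≢ _ (suc q) _ i p (ℕₚ.<⇒≢ (ℕₚ.m<n⇒m<1+n p<q)) ⟩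
    setColumn A q (column A (suc q)) i p    ≡⟨ setColumn-≢ A q _ i p p≢q ⟩
    A i p                                   ≡⟨ cols≡ i ⟩
    A i (suc q)                             ≡⟨ setColumn-≡ A q _ i ⟨
    setColumn A q (column A (suc q)) i q    ≡⟨ setColumn-≢ _ (suc q) _ i q (ℕₚ.<⇒≢ (ℕₚ.n<1+n q)) ⟨
    S (column A (suc q)) (column A q) i q   ∎

detℕ-add-earlier-columns : ∀ m n c (A B : Matrix) (w : ℕ → ℤ) → c < n → m ≤ c →
  (∀ i j → j ≢ c → B i j ≡ A i j) → (∀ i → B i c ≡ A i c + ∑ m (λ l → w l * A i l)) →
  detℕ n B ≡ detℕ n A
detℕ-add-earlier-columns m n c A B w c<n m≤c B≡A B-col = begin
  detℕ n B                                ≡⟨ detℕ-cong n (λ i j _ _ → B≡set i j) ⟩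
  detℕ n (setColumn A c (combination m))  ≡⟨ go m m≤c ⟩
  detℕ n A                                ∎
  where
  open ≡-Reasoning
  combination : ℕ → ℕ → ℤ
  combination m i = A i c + ∑ m (λ l → w l * A i l)
  B≡set : ∀ i j → B i j ≡ setColumn A c (combination m) i j
  B≡set i j with j ℕ.≟ c
  ... | yes refl = B-col i
  ... | no  j≢c  = B≡A i j j≢c
  go : ∀ m → m ≤ c → detℕ n (setColumn A c (combination m)) ≡ detℕ n A
  go zero _ = detℕ-cong n λ i j _ _ → trans (drop-empty-sum i j) (setColumn-self A c i j)
    where
    drop-empty-sum : ∀ i j → setColumn A c (combination 0) i j ≡ setColumn A c (column A c) i j
    drop-empty-sum i j with j ℕ.≟ c
    ... | yes _ = ℤₚ.+-identityʳ (A i c)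
    ... | no  _ = refl
  go (suc m) m<c = begin
    detℕ n (setColumn A c (combination (suc m)))                       ≡⟨ detℕ-cong n (λ i j _ _ → peel i j) ⟩
    detℕ n (setColumn A c (λ i → w m * A i m + combination m i))        ≡⟨ detℕ-setColumn-linear n c (w m) A (column A m) (combination m) c<n ⟩
    w m * detℕ n (setColumn A c (column A m)) + detℕ n (setColumn A c (combination m))
                                                                      ≡⟨ cong (λ x → w m * x + detℕ n (setColumn A c (combination m)))
                                                                           repeated-column ⟩
    w m * + 0 + detℕ n (setColumn A c (combination m))                ≡⟨ cong (_+ detℕ n (setColumn A c (combination m)))
                                                                           (ℤₚ.*-zeroʳ (w m)) ⟩
    + 0 + detℕ n (setColumn A c (combination m))                      ≡⟨ ℤₚ.+-identityˡ _ ⟩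
    detℕ n (setColumn A c (combination m))                            ≡⟨ go m (ℕₚ.<⇒≤ m<c) ⟩
    detℕ n A                                                          ∎
    where
    m≢c : m ≢ c
    m≢c = ℕₚ.<⇒≢ m<c
    peel : ∀ i j → setColumn A c (combination (suc m)) i j ≡ setColumn A c (λ i → w m * A i m + combination m i) i j
    peel i j with j ℕ.≟ c
    ... | no  _ = refl
    ... | yes _ = begin
      A i c + ∑ (suc m) (λ l → w l * A i l)          ≡⟨ cong (λ x → A i c + x) (∑-last m (λ l → w l * A i l)) ⟩
      A i c + (∑ m (λ l → w l * A i l) + w m * A i m) ≡⟨ rearrange (A i c) (∑ m (λ l → w l * A i l)) (w m * A i m) ⟩
      w m * A i m + (A i c + ∑ m (λ l → w l * A i l)) ∎
      where rearrange : ∀ a s t → a + (s + t) ≡ t + (a + s)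
            rearrange = solve-∀
    repeated-column : detℕ n (setColumn A c (column A m)) ≡ + 0
    repeated-column = detℕ-equal-columns n m c (setColumn A c (column A m)) m<c c<n
      (λ i → trans (setColumn-≢ A c _ i m m≢c) (sym (setColumn-≡ A c _ i)))

mul : ℕ → Matrix → Matrix → Matrix
mul n A B i j = ∑ n (λ l → A i l * B l j)

UnitUpperTriangular : Matrix → Set
UnitUpperTriangular U = (∀ l j → j < l → U l j ≡ + 0) × (∀ j → U j j ≡ + 1)

mul-unitUpper-column : ∀ n X U → UnitUpperTriangular U → ∀ t i → t < n →
  mul n X U i t ≡ X i t + ∑ t (λ l → U l t * X i l)
mul-unitUpper-column n X U (U-upper , U-diag) t i t<n = begin
  ∑ n (λ l → X i l * U l t)                    ≡⟨ ∑-truncate (suc t) n _ t<n (λ l t<l _ →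
                                                    trans (cong (X i l *_) (U-upper l t t<l)) (ℤₚ.*-zeroʳ (X i l))) ⟩
  ∑ (suc t) (λ l → X i l * U l t)              ≡⟨ ∑-last t _ ⟩
  ∑ t (λ l → X i l * U l t) + X i t * U t t    ≡⟨ cong₂ _+_ (∑-cong t (λ l _ → ℤₚ.*-comm (X i l) (U l t)))
                                                    (cong (X i t *_) (U-diag t)) ⟩
  ∑ t (λ l → U l t * X i l) + X i t * + 1      ≡⟨ rearrange _ (X i t) ⟩
  X i t + ∑ t (λ l → U l t * X i l)            ∎
  where
  open ≡-Reasoning
  rearrange : ∀ s x → s + x * + 1 ≡ x + s
  rearrange = solve-∀

-- Restore the columns of X from left to right, each time removing a combination of earlier columns.
detℕ-mul-unitUpper : ∀ n X U → UnitUpperTriangular U → detℕ n (mul n X U) ≡ detℕ n X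
detℕ-mul-unitUpper n X U U-unitUpper = begin
  detℕ n (mul n X U)   ≡⟨ detℕ-cong n (λ i j _ _ → sym (mixed-≮ 0 i j λ ())) ⟩
  detℕ n (mixed 0)     ≡⟨ go n 0 (ℕₚ.+-identityʳ n) ⟩
  detℕ n X             ∎
  where
  open ≡-Reasoning
  mixed : ℕ → Matrix
  mixed t i j with j ℕ.<? t
  ... | yes _ = X i j
  ... | no  _ = mul n X U i j
  mixed-< : ∀ t i j → j < t → mixed t i j ≡ X i j
  mixed-< t i j j<t with j ℕ.<? t
  ... | yes _   = refl
  ... | no  j≮t = ⊥-elim (j≮t j<t)
  mixed-≮ : ∀ t i j → ¬ j < t → mixed t i j ≡ mul n X U i j
  mixed-≮ t i j j≮t with j ℕ.<? t
  ... | yes j<t = ⊥-elim (j≮t j<t)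
  ... | no  _   = refl
  step : ∀ t → t < n → detℕ n (mixed t) ≡ detℕ n (mixed (suc t))
  step t t<n = detℕ-add-earlier-columns t n t (mixed (suc t)) (mixed t) (λ l → U l t) t<n ℕₚ.≤-refl same-off-t column-t
    where
    same-off-t : ∀ i j → j ≢ t → mixed t i j ≡ mixed (suc t) i j
    same-off-t i j j≢t with j ℕ.<? t
    ... | yes j<t = sym (mixed-< (suc t) i j (ℕₚ.m<n⇒m<1+n j<t))
    ... | no  j≮t = sym (mixed-≮ (suc t) i j (λ j<st → j≮t (ℕₚ.≤∧≢⇒< (ℕₚ.≤-pred j<st) j≢t)))
    column-t : ∀ i → mixed t i t ≡ mixed (suc t) i t + ∑ t (λ l → U l t * mixed (suc t) i l)
    column-t i = begin
      mixed t i t                              ≡⟨ mixed-≮ t i t (ℕₚ.n≮n t) ⟩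
      mul n X U i t                            ≡⟨ mul-unitUpper-column n X U U-unitUpper t i t<n ⟩
      X i t + ∑ t (λ l → U l t * X i l)        ≡⟨ cong₂ _+_ (mixed-< (suc t) i t (ℕₚ.n<1+n t))
                                                    (∑-cong t (λ l l<t → cong (U l t *_) (mixed-< (suc t) i l (ℕₚ.m<n⇒m<1+n l<t)))) ⟨
      mixed (suc t) i t + ∑ t (λ l → U l t * mixed (suc t) i l) ∎
  go : ∀ k t → k ℕ.+ t ≡ n → detℕ n (mixed t) ≡ detℕ n X
  go zero    t refl = detℕ-cong n (λ i j _ j<n → mixed-< t i j j<n)
  go (suc k) t k+t≡n = trans (step t t<n) (go k (suc t) (trans (ℕₚ.+-suc k t) k+t≡n))
    where t<n : t < n
          t<n = subst (t <_) k+t≡n (s≤s (ℕₚ.m≤n+m t k))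

detℕ-row₀ : ∀ n M → (∀ j → j < n → M 0 (suc j) ≡ + 0) → detℕ (suc n) M ≡ M 0 0 * detℕ n (minor M 0)
detℕ-row₀ n M row₀≡0 = begin
  detℕ (suc n) M                                          ≡⟨ detℕ-expand n M ⟩
  laplaceTerm n M 0 + ∑ n (laplaceTerm n M ∘ suc)         ≡⟨ cong₂ _+_ (cong (_* detℕ n (minor M 0)) (ℤₚ.*-identityˡ (M 0 0)))
                                                               (∑-zeros n term≡0) ⟩
  M 0 0 * detℕ n (minor M 0) + + 0                        ≡⟨ ℤₚ.+-identityʳ _ ⟩
  M 0 0 * detℕ n (minor M 0)                              ∎
  where
  open ≡-Reasoning
  term≡0 : ∀ j → j < n → laplaceTerm n M (suc j) ≡ + 0
  term≡0 j j<n = begin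
    sign (suc j) * M 0 (suc j) * detℕ n (minor M (suc j)) ≡⟨ cong (λ x → sign (suc j) * x * detℕ n (minor M (suc j))) (row₀≡0 j j<n) ⟩
    sign (suc j) * + 0 * detℕ n (minor M (suc j))         ≡⟨ cong (_* detℕ n (minor M (suc j))) (ℤₚ.*-zeroʳ (sign (suc j))) ⟩
    + 0 * detℕ n (minor M (suc j))                        ≡⟨ ℤₚ.*-zeroˡ (detℕ n (minor M (suc j))) ⟩
    + 0                                                   ∎

detℕ-scale : ∀ n (c : ℤ) (M : Matrix) → detℕ n (λ i j → c * M i j) ≡ c ^ n * detℕ n M
detℕ-scale zero    c M = refl
detℕ-scale (suc n) c M = begin
  detℕ (suc n) (λ i j → c * M i j)                 ≡⟨ detℕ-expand n (λ i j → c * M i j) ⟩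
  ∑ (suc n) (laplaceTerm n (λ i j → c * M i j))    ≡⟨ ∑-cong (suc n) (λ j _ → termwise j) ⟩
  ∑ (suc n) (λ j → c ^ suc n * laplaceTerm n M j)  ≡⟨ ∑-scaleˡ (suc n) (c ^ suc n) (laplaceTerm n M) ⟩
  c ^ suc n * ∑ (suc n) (laplaceTerm n M)          ≡⟨ cong (c ^ suc n *_) (detℕ-expand n M) ⟨
  c ^ suc n * detℕ (suc n) M                       ∎
  where
  open ≡-Reasoning
  termwise : ∀ j → laplaceTerm n (λ i j → c * M i j) j ≡ c ^ suc n * laplaceTerm n M j
  termwise j = trans (cong (sign j * (c * M 0 j) *_) (detℕ-scale n c (minor M j)))
                     (rearrange (sign j) c (M 0 j) (c ^ n) (detℕ n (minor M j)))
    where rearrange : ∀ g c x p d → g * (c * x) * (p * d) ≡ c * p * (g * x * d)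
          rearrange = solve-∀

mul-assoc : ∀ n A B C i j → mul n (mul n A B) C i j ≡ mul n A (mul n B C) i j
mul-assoc n A B C i j = begin
  ∑ n (λ l → ∑ n (λ k → A i k * B k l) * C l j)   ≡⟨ ∑-cong n (λ l _ → trans (∑-scaleʳ n _ (C l j))
                                                       (∑-cong n (λ k _ → ℤₚ.*-assoc (A i k) (B k l) (C l j)))) ⟩
  ∑ n (λ l → ∑ n (λ k → A i k * (B k l * C l j)))  ≡⟨ ∑-comm n n (λ l k → A i k * (B k l * C l j)) ⟩
  ∑ n (λ k → ∑ n (λ l → A i k * (B k l * C l j)))  ≡⟨ ∑-cong n (λ k _ → ∑-scaleˡ n (A i k) (λ l → B k l * C l j)) ⟩
  ∑ n (λ k → A i k * ∑ n (λ l → B k l * C l j))    ∎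
  where open ≡-Reasoning

LowerTriangular : Matrix → Set
LowerTriangular A = ∀ i k → i < k → A i k ≡ + 0

UnitLowerTriangular : ℕ → Matrix → Set
UnitLowerTriangular n Λ = LowerTriangular Λ × (∀ i → i < n → Λ i i ≡ + 1)

mul-lower : ∀ n A B → LowerTriangular A → LowerTriangular B → LowerTriangular (mul n A B)
mul-lower n A B A-lower B-lower i k i<k = ∑-zeros n term≡0
  where
  term≡0 : ∀ l → l < n → A i l * B l k ≡ + 0
  term≡0 l _ with ℕₚ.<-cmp i l
  ... | tri< i<l _ _ = trans (cong (_* B l k) (A-lower i l i<l)) (ℤₚ.*-zeroˡ (B l k))
  ... | tri≈ _ refl _ = trans (cong (A i l *_) (B-lower l k i<k)) (ℤₚ.*-zeroʳ (A i l))
  ... | tri> _ _ l<i = trans (cong (A i l *_) (B-lower l k (ℕₚ.<-trans l<i i<k))) (ℤₚ.*-zeroʳ (A i l))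

mul-lower-diagonal : ∀ n A B → LowerTriangular A → LowerTriangular B → ∀ i → i < n → mul n A B i i ≡ A i i * B i i
mul-lower-diagonal n A B A-lower B-lower i i<n = ∑-single n i _ i<n term≡0
  where
  term≡0 : ∀ l → l < n → l ≢ i → A i l * B l i ≡ + 0
  term≡0 l _ l≢i with ℕₚ.<-cmp i l
  ... | tri< i<l _ _ = trans (cong (_* B l i) (A-lower i l i<l)) (ℤₚ.*-zeroˡ (B l i))
  ... | tri≈ _ i≡l _ = ⊥-elim (l≢i (sym i≡l))
  ... | tri> _ _ l<i = trans (cong (A i l *_) (B-lower l i l<i)) (ℤₚ.*-zeroʳ (A i l))

-- Power series and continued fractions

toeplitz : Series → Matrix
toeplitz v zero    j       = v j
toeplitz v (suc l) zero    = + 0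
toeplitz v (suc l) (suc j) = toeplitz v l j

toeplitz-> : ∀ v l j → j < l → toeplitz v l j ≡ + 0
toeplitz-> v (suc l) zero    _         = refl
toeplitz-> v (suc l) (suc j) (s≤s j<l) = toeplitz-> v l j j<l

toeplitz-diagonal : ∀ v j → toeplitz v j j ≡ v 0
toeplitz-diagonal v zero    = refl
toeplitz-diagonal v (suc j) = toeplitz-diagonal v j

toeplitz-shift : ∀ v i l j → toeplitz v (i ℕ.+ l) (i ℕ.+ j) ≡ toeplitz v l j
toeplitz-shift v zero    l j = refl
toeplitz-shift v (suc i) l j = toeplitz-shift v i l j

toeplitz-≤ : ∀ v l j → l ≤ j → toeplitz v l j ≡ v (j ∸ l)
toeplitz-≤ v zero    j       _         = refl
toeplitz-≤ v (suc l) (suc j) (s≤s l≤j) = toeplitz-≤ v l j l≤j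

toeplitz-suc : ∀ v m n → m ≤ n → toeplitz v m (suc n) ≡ toeplitz (v ∘ suc) m n
toeplitz-suc v zero    n       _         = refl
toeplitz-suc v (suc m) (suc n) (s≤s m≤n) = toeplitz-suc v m n m≤n

-- The Cauchy product, written with toeplitz to avoid truncated subtraction.
_⋆_ : Series → Series → Series
(u ⋆ w) n = ∑ (suc n) (λ m → u m * toeplitz w m n)

onePlusX : Series → Series
onePlusX g zero    = + 1
onePlusX g (suc s) = g s

-- u (1 + x v) is constant, i.e. u = u₀ / (1 + x v).
IsScaledInverse : Series → Series → Set
IsScaledInverse u v = ∀ N → (u ⋆ onePlusX v) (suc N) ≡ + 0

-- The coefficient of x^(i+1+j) in u (1 + x v) vanishes; split its sum at index i.
scaledInverse-split : ∀ u v → IsScaledInverse u v → ∀ i j →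
  ∑ (suc j) (λ l → u (suc i ℕ.+ l) * toeplitz (onePlusX v) l j) ≡ - ∑ (suc i) (λ k → toeplitz u k i * v (k ℕ.+ j))
scaledInverse-split u v u/v i j = trans (neg-unique lower+upper≡0) (cong -_ lower≡)
  where
  term : ℕ → ℤ
  term m = u m * toeplitz (onePlusX v) m (suc (i ℕ.+ j))
  lower+upper≡0 : ∑ (suc i) term + ∑ (suc j) (λ l → u (suc i ℕ.+ l) * toeplitz (onePlusX v) l j) ≡ + 0
  lower+upper≡0 = begin
    ∑ (suc i) term + ∑ (suc j) (λ l → u (suc i ℕ.+ l) * toeplitz (onePlusX v) l j)
      ≡⟨ cong (λ x → ∑ (suc i) term + x)
           (∑-cong (suc j) (λ l _ → cong (u (suc i ℕ.+ l) *_) (toeplitz-shift (onePlusX v) (suc i) l j))) ⟨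
    ∑ (suc i) term + ∑ (suc j) (λ l → term (suc i ℕ.+ l))
      ≡⟨ ∑-split (suc i) (suc j) term ⟨
    ∑ (suc i ℕ.+ suc j) term
      ≡⟨ cong (λ n → ∑ n term) (ℕₚ.+-suc (suc i) j) ⟩
    (u ⋆ onePlusX v) (suc (i ℕ.+ j))
      ≡⟨ u/v (i ℕ.+ j) ⟩
    + 0 ∎
    where open ≡-Reasoning
  lower≡ : ∑ (suc i) term ≡ ∑ (suc i) (λ k → toeplitz u k i * v (k ℕ.+ j))
  lower≡ = begin
    ∑ (suc i) term
      ≡⟨ ∑-cong (suc i) (λ m m≤i → cong (u m *_) (begin
           toeplitz (onePlusX v) m (suc (i ℕ.+ j)) ≡⟨ toeplitz-suc (onePlusX v) m (i ℕ.+ j) (m≤i+j m≤i) ⟩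
           toeplitz v m (i ℕ.+ j)                  ≡⟨ toeplitz-≤ v m (i ℕ.+ j) (m≤i+j m≤i) ⟩
           v (i ℕ.+ j ∸ m)                         ≡⟨ cong v (ℕₚ.+-∸-comm j (ℕₚ.≤-pred m≤i)) ⟩
           v (i ∸ m ℕ.+ j)                         ∎)) ⟩
    ∑ (suc i) (λ m → u m * v (i ∸ m ℕ.+ j))
      ≡⟨ ∑-reverse i (λ m k → u m * v (k ℕ.+ j)) ⟩
    ∑ (suc i) (λ k → u (i ∸ k) * v (k ℕ.+ j))
      ≡⟨ ∑-cong (suc i) (λ k k≤i → cong (_* v (k ℕ.+ j)) (sym (toeplitz-≤ u k i (ℕₚ.≤-pred k≤i)))) ⟩
    ∑ (suc i) (λ k → toeplitz u k i * v (k ℕ.+ j)) ∎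
    where
    open ≡-Reasoning
    m≤i+j : ∀ {m} → m < suc i → m ≤ i ℕ.+ j
    m≤i+j m≤i = ℕₚ.≤-trans (ℕₚ.≤-pred m≤i) (ℕₚ.m≤m+n i j)
  neg-unique : ∀ {x y} → x + y ≡ + 0 → y ≡ - x
  neg-unique {x} {y} x+y≡0 = trans (rearrange x y) (trans (cong (λ z → - x + z) x+y≡0) (ℤₚ.+-identityʳ (- x)))
    where rearrange : ∀ x y → y ≡ - x + (x + y)
          rearrange = solve-∀

⋆-suc : ∀ u w n → (u ⋆ w) (suc n) ≡ (u ⋆ (w ∘ suc)) n + u (suc n) * w 0
⋆-suc u w n = begin
  (u ⋆ w) (suc n)                                                    ≡⟨ ∑-last (suc n) (λ m → u m * toeplitz w m (suc n)) ⟩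
  ∑ (suc n) (λ m → u m * toeplitz w m (suc n)) + u (suc n) * toeplitz w (suc n) (suc n)
                                                                     ≡⟨ cong₂ _+_ (∑-cong (suc n) (λ m m≤n →
                                                                          cong (u m *_) (toeplitz-suc w m n (ℕₚ.≤-pred m≤n))))
                                                                          (cong (u (suc n) *_) (toeplitz-diagonal w (suc n))) ⟩
  (u ⋆ (w ∘ suc)) n + u (suc n) * w 0                                ∎
  where open ≡-Reasoning

dot-invRev : ∀ g n h → dot h (invRev g n) ≡ (invOnePlusX g ⋆ h) n
dot-invRev g zero    h = trans (ℤₚ.+-identityʳ (h 0 * + 1)) (trans (ℤₚ.*-comm (h 0) (+ 1)) (sym (ℤₚ.+-identityʳ (+ 1 * h 0))))
dot-invRev g (suc n) h = begin
  h 0 * q (suc n) + dot (h ∘ suc) (invRev g n)   ≡⟨ cong (λ x → h 0 * q (suc n) + x) (dot-invRev g n (h ∘ suc)) ⟩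
  h 0 * q (suc n) + (q ⋆ (h ∘ suc)) n            ≡⟨ rearrange (h 0) (q (suc n)) ((q ⋆ (h ∘ suc)) n) ⟩
  (q ⋆ (h ∘ suc)) n + q (suc n) * h 0            ≡⟨ ⋆-suc q h n ⟨
  (q ⋆ h) (suc n)                                ∎
  where
  open ≡-Reasoning
  q = invOnePlusX g
  rearrange : ∀ h x s → h * x + s ≡ s + x * h
  rearrange = solve-∀

invOnePlusX-isScaledInverse : ∀ g → IsScaledInverse (invOnePlusX g) g
invOnePlusX-isScaledInverse g N = begin
  (invOnePlusX g ⋆ onePlusX g) (suc N)             ≡⟨ ⋆-suc (invOnePlusX g) (onePlusX g) N ⟩
  (invOnePlusX g ⋆ g) N + (- d) * + 1              ≡⟨ cong (λ x → x + (- d) * + 1) (dot-invRev g N g) ⟨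
  d + (- d) * + 1                                  ≡⟨ cancel d ⟩
  + 0                                              ∎
  where
  open ≡-Reasoning
  d = dot g (invRev g N)
  cancel : ∀ d → d + (- d) * + 1 ≡ + 0
  cancel = solve-∀

invRev-cong : ∀ n g g′ → (∀ m → m < n → g m ≡ g′ m) → invRev g n ≡ invRev g′ n
invRev-cong zero    g g′ g≡g′ = refl
invRev-cong (suc n) g g′ g≡g′ = cong₂ _∷_ (cong -_ dot≡) invRev≡
  where
  invRev≡ = invRev-cong n g g′ (λ m m<n → g≡g′ m (ℕₚ.m<n⇒m<1+n m<n))
  dot≡ : dot g (invRev g n) ≡ dot g′ (invRev g′ n)
  dot≡ = begin
    dot g (invRev g n)          ≡⟨ cong (dot g) invRev≡ ⟩
    dot g (invRev g′ n)         ≡⟨ dot-invRev g′ n g ⟩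
    (invOnePlusX g′ ⋆ g) n      ≡⟨ ∑-cong (suc n) (λ m m≤n → cong (invOnePlusX g′ m *_) (begin
                                     toeplitz g m n   ≡⟨ toeplitz-≤ g m n (ℕₚ.≤-pred m≤n) ⟩
                                     g (n ∸ m)        ≡⟨ g≡g′ (n ∸ m) (s≤s (ℕₚ.m∸n≤m n m)) ⟩
                                     g′ (n ∸ m)       ≡⟨ toeplitz-≤ g′ m n (ℕₚ.≤-pred m≤n) ⟨
                                     toeplitz g′ m n  ∎)) ⟩
    (invOnePlusX g′ ⋆ g′) n     ≡⟨ dot-invRev g′ n g′ ⟨
    dot g′ (invRev g′ n)        ∎
    where open ≡-Reasoning

invOnePlusX-cong : ∀ n g g′ → (∀ m → m < n → g m ≡ g′ m) → invOnePlusX g n ≡ invOnePlusX g′ n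
invOnePlusX-cong n g g′ g≡g′ = cong headℤ (invRev-cong n g g′ g≡g′)

module _ (a : ℕ → ℤ) where

  cfTail-0 : ∀ d k → cfTail a d k 0 ≡ a k
  cfTail-0 zero    k = refl
  cfTail-0 (suc d) k = ℤₚ.*-identityʳ (a k)

  cfTail-stable : ∀ m d k → m ≤ d → cfTail a d k m ≡ cfTail a m k m
  cfTail-stable m d k m≤d = go m m d k ℕₚ.≤-refl m≤d
    where
    -- bound only makes the recursion through all m′ ≤ m structural.
    go : ∀ bound m d k → m ≤ bound → m ≤ d → cfTail a d k m ≡ cfTail a m k m
    go bound       zero    d       k _ _ = cfTail-0 d k
    go (suc bound) (suc m) (suc d) k (s≤s m≤b) (s≤s m≤d) =
      cong (a k *_) (invOnePlusX-cong (suc m) _ _ λ m′ m′≤m →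
        let m′≤b = ℕₚ.≤-trans (ℕₚ.≤-pred m′≤m) m≤b in
        trans (go bound m′ d (suc k) m′≤b (ℕₚ.≤-trans (ℕₚ.≤-pred m′≤m) m≤d))
              (sym (go bound m′ m (suc k) m′≤b (ℕₚ.≤-pred m′≤m))))

  -- The tail a_k/(1 + a_{k+1}x/(1 + ⋯)); its n-th coefficient is read off the truncation of depth n.
  cfLimit : ℕ → Series
  cfLimit k n = cfTail a n k n

  cfLimit-unfold : ∀ k n → cfLimit k n ≡ a k * invOnePlusX (cfLimit (suc k)) n
  cfLimit-unfold k zero    = sym (ℤₚ.*-identityʳ (a k))
  cfLimit-unfold k (suc n) = cong (a k *_) (invOnePlusX-cong (suc n) _ _ λ m m≤n →
    cfTail-stable m n (suc k) (ℕₚ.≤-pred m≤n))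

  cfLimit-isScaledInverse : ∀ k → IsScaledInverse (cfLimit k) (cfLimit (suc k))
  cfLimit-isScaledInverse k N = begin
    (cfLimit k ⋆ onePlusX g) (suc N)               ≡⟨ ∑-cong (suc (suc N)) (λ m _ → trans
                                                        (cong (_* toeplitz (onePlusX g) m (suc N)) (cfLimit-unfold k m))
                                                        (ℤₚ.*-assoc (a k) (invOnePlusX g m) _)) ⟩
    ∑ (suc (suc N)) (λ m → a k * (invOnePlusX g m * toeplitz (onePlusX g) m (suc N)))
                                                   ≡⟨ ∑-scaleˡ (suc (suc N)) (a k) (λ m → invOnePlusX g m * toeplitz (onePlusX g) m (suc N)) ⟩
    a k * (invOnePlusX g ⋆ onePlusX g) (suc N)     ≡⟨ cong (a k *_) (invOnePlusX-isScaledInverse g N) ⟩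
    a k * + 0                                      ≡⟨ ℤₚ.*-zeroʳ (a k) ⟩
    + 0                                            ∎
    where
    open ≡-Reasoning
    g = cfLimit (suc k)

  IsStieltjesCF⇒cfLimit : ∀ f → IsStieltjesCF a f → ∀ n → f n ≡ cfLimit 0 n
  IsStieltjesCF⇒cfLimit f f-limit n with f-limit n
  ... | N , stable = trans (sym (stable (N ⊔ n) (ℕₚ.m≤m⊔n N n))) (cfTail-stable n (N ⊔ n) 0 (ℕₚ.m≤n⊔m N n))

-- Hankel determinants of Stieltjes continued fractions

hankelMatrix : Series → Matrix
hankelMatrix u i j = u (i ℕ.+ j)

scaledLowerToeplitz : ℤ → Series → Matrix
scaledLowerToeplitz c g i k = c * toeplitz g k i

toeplitz-onePlusX-unitUpper : ∀ h → UnitUpperTriangular (toeplitz (onePlusX h))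
toeplitz-onePlusX-unitUpper h = (λ l j j<l → toeplitz-> (onePlusX h) l j j<l) , toeplitz-diagonal (onePlusX h)

∑-toeplitz-truncate : ∀ n (f : ℕ → ℤ) v j → j < n →
  ∑ n (λ l → f l * toeplitz v l j) ≡ ∑ (suc j) (λ l → f l * toeplitz v l j)
∑-toeplitz-truncate n f v j j<n = ∑-truncate (suc j) n _ j<n λ l j<l _ →
  trans (cong (f l *_) (toeplitz-> v l j j<l)) (ℤₚ.*-zeroʳ (f l))

scaledLowerToeplitz-lower : ∀ c g → LowerTriangular (scaledLowerToeplitz c g)
scaledLowerToeplitz-lower c g i k i<k = trans (cong (c *_) (toeplitz-> g k i i<k)) (ℤₚ.*-zeroʳ c)

mul-scaledLowerToeplitz-unitLower : ∀ n Λ c g → UnitLowerTriangular n Λ → g 0 ≡ c → c * c ≡ + 1 →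
  UnitLowerTriangular n (mul n Λ (scaledLowerToeplitz c g))
mul-scaledLowerToeplitz-unitLower n Λ c g (Λ-lower , Λ-diag) g₀≡c c²≡1 =
  mul-lower n Λ _ Λ-lower (scaledLowerToeplitz-lower c g) , λ i i<n → begin
    mul n Λ (scaledLowerToeplitz c g) i i       ≡⟨ mul-lower-diagonal n Λ _ Λ-lower (scaledLowerToeplitz-lower c g) i i<n ⟩
    Λ i i * (c * toeplitz g i i)                ≡⟨ cong₂ _*_ (Λ-diag i i<n) (cong (c *_) (trans (toeplitz-diagonal g i) g₀≡c)) ⟩
    + 1 * (c * c)                               ≡⟨ trans (ℤₚ.*-identityˡ (c * c)) c²≡1 ⟩
    + 1                                         ∎
  where open ≡-Reasoning

-- Multiplying by - c undoes the factor c, since c² = 1.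
scaledLowerToeplitz-mul : ∀ n c g (G : Matrix) i j → i < n → c * c ≡ + 1 →
  (- c) * mul n (scaledLowerToeplitz c g) G i j ≡ - ∑ (suc i) (λ k → toeplitz g k i * G k j)
scaledLowerToeplitz-mul n c g G i j i<n c²≡1 = begin
  (- c) * ∑ n (λ k → c * toeplitz g k i * G k j)
    ≡⟨ cong ((- c) *_) (∑-truncate (suc i) n _ i<n λ k i<k _ →
         trans (cong (_* G k j) (scaledLowerToeplitz-lower c g i k i<k)) (ℤₚ.*-zeroˡ (G k j))) ⟩
  (- c) * ∑ (suc i) (λ k → c * toeplitz g k i * G k j)
    ≡⟨ cong ((- c) *_) (trans (∑-cong (suc i) (λ k _ → ℤₚ.*-assoc c (toeplitz g k i) (G k j))) (∑-scaleˡ (suc i) c (λ k → toeplitz g k i * G k j))) ⟩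
  (- c) * (c * S)
    ≡⟨ rearrange c S ⟩
  - (c * c * S)
    ≡⟨ cong (λ x → - (x * S)) c²≡1 ⟩
  - (+ 1 * S)
    ≡⟨ cong -_ (ℤₚ.*-identityˡ S) ⟩
  - S ∎
  where
  open ≡-Reasoning
  S = ∑ (suc i) (λ k → toeplitz g k i * G k j)
  rearrange : ∀ c x → (- c) * (c * x) ≡ - (c * c * x)
  rearrange = solve-∀

mul-column-scale : ∀ n (Λ G H : Matrix) d i j → (∀ l → l < n → G l j ≡ d * H l j) →
  mul n Λ G i j ≡ d * mul n Λ H i j
mul-column-scale n Λ G H d i j G≡dH =
  trans (∑-cong n (λ l l<n → trans (cong (Λ i l *_) (G≡dH l l<n)) (rearrange (Λ i l) d (H l j))))
        (∑-scaleˡ n d (λ l → Λ i l * H l j))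
  where rearrange : ∀ x d y → x * (d * y) ≡ d * (x * y)
        rearrange = solve-∀

hankel-suc-row-mul-onePlusX : ∀ m u v → IsScaledInverse u v → ∀ i j → j < m →
  mul m (hankelMatrix u) (toeplitz (onePlusX v)) (suc i) j ≡ - ∑ (suc i) (λ k → toeplitz u k i * v (k ℕ.+ j))
hankel-suc-row-mul-onePlusX m u v u/v i j j<m =
  trans (∑-toeplitz-truncate m (λ l → u (suc i ℕ.+ l)) (onePlusX v) j j<m) (scaledInverse-split u v u/v i j)

-- Right multiplication by the unit upper triangular Toeplitz matrix of 1 + x h turns the
-- shifted Hankel matrix of g = g₀/(1 + x h) into - c times a lower triangular matrix times that of h.
detℕ-shiftedHankel : ∀ n Λ g h c → IsScaledInverse g h → c * c ≡ + 1 →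
  detℕ n (mul n Λ (hankelMatrix (g ∘ suc))) ≡
  (- c) ^ n * detℕ n (mul n (mul n Λ (scaledLowerToeplitz c g)) (hankelMatrix h))
detℕ-shiftedHankel n Λ g h c g/h c²≡1 = begin
  detℕ n (mul n Λ S)                          ≡⟨ detℕ-mul-unitUpper n (mul n Λ S) U (toeplitz-onePlusX-unitUpper h) ⟨
  detℕ n (mul n (mul n Λ S) U)                ≡⟨ detℕ-cong n entrywise ⟩
  detℕ n (λ i j → (- c) * mul n (mul n Λ T) H i j) ≡⟨ detℕ-scale n (- c) (mul n (mul n Λ T) H) ⟩
  (- c) ^ n * detℕ n (mul n (mul n Λ T) H)    ∎
  where
  open ≡-Reasoning
  S = hankelMatrix (g ∘ suc)
  U = toeplitz (onePlusX h)
  T = scaledLowerToeplitz c g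
  H = hankelMatrix h
  entrywise : ∀ i j → i < n → j < n → mul n (mul n Λ S) U i j ≡ (- c) * mul n (mul n Λ T) H i j
  entrywise i j _ j<n = begin
    mul n (mul n Λ S) U i j      ≡⟨ mul-assoc n Λ S U i j ⟩
    mul n Λ (mul n S U) i j      ≡⟨ mul-column-scale n Λ (mul n S U) (mul n T H) (- c) i j (λ l l<n →
                                      trans (hankel-suc-row-mul-onePlusX n g h g/h l j j<n)
                                            (sym (scaledLowerToeplitz-mul n c g H l j l<n c²≡1))) ⟩
    (- c) * mul n Λ (mul n T H) i j ≡⟨ cong ((- c) *_) (mul-assoc n Λ T H i j) ⟨
    (- c) * mul n (mul n Λ T) H i j ∎

mul-lower-row₀ : ∀ n Λ (Y : Matrix) j → LowerTriangular Λ → mul (suc n) Λ Y 0 j ≡ Λ 0 0 * Y 0 j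
mul-lower-row₀ n Λ Y j Λ-lower = ∑-single (suc n) 0 (λ l → Λ 0 l * Y l j) (s≤s z≤n) λ where
  zero    _ 0≢0 → ⊥-elim (0≢0 refl)
  (suc l) _ _   → trans (cong (_* Y (suc l) j) (Λ-lower 0 (suc l) (s≤s z≤n))) (ℤₚ.*-zeroˡ (Y (suc l) j))

mul-minor₀ : ∀ n Λ (Y : Matrix) i j → Y 0 (suc j) ≡ + 0 →
  mul (suc n) Λ Y (suc i) (suc j) ≡ mul n (minor Λ 0) (minor Y 0) i j
mul-minor₀ n Λ Y i j Y₀≡0 = begin
  Λ (suc i) 0 * Y 0 (suc j) + mul n (minor Λ 0) (minor Y 0) i j ≡⟨ cong (λ x → Λ (suc i) 0 * x + mul n (minor Λ 0) (minor Y 0) i j) Y₀≡0 ⟩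
  Λ (suc i) 0 * + 0 + mul n (minor Λ 0) (minor Y 0) i j         ≡⟨ cong (_+ mul n (minor Λ 0) (minor Y 0) i j) (ℤₚ.*-zeroʳ (Λ (suc i) 0)) ⟩
  + 0 + mul n (minor Λ 0) (minor Y 0) i j                       ≡⟨ ℤₚ.+-identityˡ _ ⟩
  mul n (minor Λ 0) (minor Y 0) i j                             ∎
  where open ≡-Reasoning

hankel-mul-onePlusX-row₀ : ∀ n u g → IsScaledInverse u g → ∀ j → j < n →
  mul (suc n) (hankelMatrix u) (toeplitz (onePlusX g)) 0 (suc j) ≡ + 0
hankel-mul-onePlusX-row₀ n u g u/g j j<n = trans (∑-toeplitz-truncate (suc n) u (onePlusX g) (suc j) (s≤s j<n)) (u/g j)

hankel-mul-onePlusX-corner : ∀ n u g → mul (suc n) (hankelMatrix u) (toeplitz (onePlusX g)) 0 0 ≡ u 0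
hankel-mul-onePlusX-corner n u g = begin
  mul (suc n) (hankelMatrix u) (toeplitz (onePlusX g)) 0 0  ≡⟨ ∑-toeplitz-truncate (suc n) u (onePlusX g) 0 (s≤s z≤n) ⟩
  u 0 * + 1 + + 0                                           ≡⟨ trans (ℤₚ.+-identityʳ _) (ℤₚ.*-identityʳ (u 0)) ⟩
  u 0                                                       ∎
  where open ≡-Reasoning

-- The same multiplication clears the first row of the Hankel matrix of u = c/(1 + x g)
-- except for its corner entry c.
detℕ-hankel-peel : ∀ n Λ u g c → IsScaledInverse u g → u 0 ≡ c → c * c ≡ + 1 → UnitLowerTriangular (suc n) Λ →
  detℕ (suc n) (mul (suc n) Λ (hankelMatrix u)) ≡
  c * ((- c) ^ n * detℕ n (mul n (mul n (minor Λ 0) (scaledLowerToeplitz c u)) (hankelMatrix (g ∘ suc))))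
detℕ-hankel-peel n Λ u g c u/g u₀≡c c²≡1 (Λ-lower , Λ-diag) = begin
  detℕ (suc n) (mul (suc n) Λ H)                  ≡⟨ detℕ-mul-unitUpper (suc n) (mul (suc n) Λ H) U (toeplitz-onePlusX-unitUpper g) ⟨
  detℕ (suc n) (mul (suc n) (mul (suc n) Λ H) U)  ≡⟨ detℕ-cong (suc n) (λ i j _ _ → mul-assoc (suc n) Λ H U i j) ⟩
  detℕ (suc n) (mul (suc n) Λ Y)                  ≡⟨ detℕ-row₀ n (mul (suc n) Λ Y) (λ j j<n →
                                                        trans (mul-lower-row₀ n Λ Y (suc j) Λ-lower)
                                                          (trans (cong (Λ 0 0 *_) (hankel-mul-onePlusX-row₀ n u g u/g j j<n))
                                                                 (ℤₚ.*-zeroʳ (Λ 0 0)))) ⟩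
  mul (suc n) Λ Y 0 0 * detℕ n (minor (mul (suc n) Λ Y) 0)
                                                  ≡⟨ cong₂ _*_ corner (detℕ-cong n inner) ⟩
  c * detℕ n (λ i j → (- c) * mul n (mul n (minor Λ 0) T) G i j)
                                                  ≡⟨ cong (c *_) (detℕ-scale n (- c) (mul n (mul n (minor Λ 0) T) G)) ⟩
  c * ((- c) ^ n * detℕ n (mul n (mul n (minor Λ 0) T) G)) ∎
  where
  open ≡-Reasoning
  H = hankelMatrix u
  U = toeplitz (onePlusX g)
  Y = mul (suc n) H U
  T = scaledLowerToeplitz c u
  G = hankelMatrix (g ∘ suc)
  corner : mul (suc n) Λ Y 0 0 ≡ c
  corner = begin
    mul (suc n) Λ Y 0 0   ≡⟨ mul-lower-row₀ n Λ Y 0 Λ-lower ⟩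
    Λ 0 0 * Y 0 0         ≡⟨ cong₂ _*_ (Λ-diag 0 (s≤s z≤n)) (hankel-mul-onePlusX-corner n u g) ⟩
    + 1 * u 0             ≡⟨ trans (ℤₚ.*-identityˡ (u 0)) u₀≡c ⟩
    c                     ∎
  Y-minor : ∀ l j → l < n → j < n → minor Y 0 l j ≡ (- c) * mul n T G l j
  Y-minor l j l<n j<n = begin
    Y (suc l) (suc j)                                     ≡⟨ hankel-suc-row-mul-onePlusX (suc n) u g u/g l (suc j) (s≤s j<n) ⟩
    - ∑ (suc l) (λ k → toeplitz u k l * g (k ℕ.+ suc j))  ≡⟨ cong -_ (∑-cong (suc l) (λ k _ →
                                                               cong (λ x → toeplitz u k l * g x) (ℕₚ.+-suc k j))) ⟩
    - ∑ (suc l) (λ k → toeplitz u k l * G k j)            ≡⟨ scaledLowerToeplitz-mul n c u G l j l<n c²≡1 ⟨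
    (- c) * mul n T G l j                                 ∎
  inner : ∀ i j → i < n → j < n → minor (mul (suc n) Λ Y) 0 i j ≡ (- c) * mul n (mul n (minor Λ 0) T) G i j
  inner i j i<n j<n = begin
    mul (suc n) Λ Y (suc i) (suc j)      ≡⟨ mul-minor₀ n Λ Y i j (hankel-mul-onePlusX-row₀ n u g u/g j j<n) ⟩
    mul n (minor Λ 0) (minor Y 0) i j    ≡⟨ mul-column-scale n (minor Λ 0) (minor Y 0) (mul n T G) (- c) i j
                                              (λ l l<n → Y-minor l j l<n j<n) ⟩
    (- c) * mul n (minor Λ 0) (mul n T G) i j ≡⟨ cong ((- c) *_) (mul-assoc n (minor Λ 0) T G i j) ⟨
    (- c) * mul n (mul n (minor Λ 0) T) G i j ∎

cfHankel : (ℕ → ℤ) → ℕ → ℕ → ℤ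
cfHankel a k zero    = + 1
cfHankel a k (suc n) = a k * ((- a k) ^ n * ((- a (suc k)) ^ n * cfHankel a (suc (suc k)) n))

identity : Matrix
identity i j = toeplitz (constSeries (+ 1)) j i

toeplitz-constSeries-≢ : ∀ c l i → l ≢ i → toeplitz (constSeries c) l i ≡ + 0
toeplitz-constSeries-≢ c zero    zero    0≢0 = ⊥-elim (0≢0 refl)
toeplitz-constSeries-≢ c zero    (suc i) _   = refl
toeplitz-constSeries-≢ c (suc l) zero    _   = refl
toeplitz-constSeries-≢ c (suc l) (suc i) l≢i = toeplitz-constSeries-≢ c l i (l≢i ∘ cong suc)

identity-unitLower : ∀ n → UnitLowerTriangular n identity
identity-unitLower n = (λ i k i<k → toeplitz-> (constSeries (+ 1)) k i i<k) , (λ i _ → toeplitz-diagonal (constSeries (+ 1)) i)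

mul-identityˡ : ∀ n H i j → i < n → mul n identity H i j ≡ H i j
mul-identityˡ n H i j i<n = begin
  mul n identity H i j    ≡⟨ ∑-single n i (λ l → identity i l * H l j) i<n (λ l _ l≢i →
                               trans (cong (_* H l j) (toeplitz-constSeries-≢ (+ 1) l i l≢i)) (ℤₚ.*-zeroˡ (H l j))) ⟩
  identity i i * H i j    ≡⟨ cong (_* H i j) (toeplitz-diagonal (constSeries (+ 1)) i) ⟩
  + 1 * H i j             ≡⟨ ℤₚ.*-identityˡ (H i j) ⟩
  H i j                   ∎
  where open ≡-Reasoning

module _ (a : ℕ → ℤ) (a²≡1 : ∀ k → a k * a k ≡ + 1) where

  -- Two peeling steps remove one row and column and pass from the tail at k to the tail at k + 2.
  detℕ-hankel-cfLimit : ∀ n k Λ → UnitLowerTriangular n Λ →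
    detℕ n (mul n Λ (hankelMatrix (cfLimit a k))) ≡ cfHankel a k n
  detℕ-hankel-cfLimit zero    k Λ _ = refl
  detℕ-hankel-cfLimit (suc n) k Λ (Λ-lower , Λ-diag) = begin
    detℕ (suc n) (mul (suc n) Λ (hankelMatrix (cfLimit a k)))
      ≡⟨ detℕ-hankel-peel n Λ (cfLimit a k) (cfLimit a (suc k)) (a k)
           (cfLimit-isScaledInverse a k) refl (a²≡1 k) (Λ-lower , Λ-diag) ⟩
    a k * ((- a k) ^ n * detℕ n (mul n Λ₂ (hankelMatrix (cfLimit a (suc k) ∘ suc))))
      ≡⟨ cong (λ x → a k * ((- a k) ^ n * x))
           (detℕ-shiftedHankel n Λ₂ (cfLimit a (suc k)) (cfLimit a (suc (suc k))) (a (suc k))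
             (cfLimit-isScaledInverse a (suc k)) (a²≡1 (suc k))) ⟩
    a k * ((- a k) ^ n * ((- a (suc k)) ^ n * detℕ n (mul n Λ₃ (hankelMatrix (cfLimit a (suc (suc k)))))))
      ≡⟨ cong (λ x → a k * ((- a k) ^ n * ((- a (suc k)) ^ n * x))) (detℕ-hankel-cfLimit n (suc (suc k)) Λ₃ Λ₃-unitLower) ⟩
    cfHankel a k (suc n) ∎
    where
    open ≡-Reasoning
    Λ₂ = mul n (minor Λ 0) (scaledLowerToeplitz (a k) (cfLimit a k))
    Λ₂-unitLower : UnitLowerTriangular n Λ₂
    Λ₂-unitLower = mul-scaledLowerToeplitz-unitLower n (minor Λ 0) (a k) (cfLimit a k)
      ((λ i j i<j → Λ-lower (suc i) (suc j) (s≤s i<j)) , (λ i i<n → Λ-diag (suc i) (s≤s i<n))) refl (a²≡1 k)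
    Λ₃ = mul n Λ₂ (scaledLowerToeplitz (a (suc k)) (cfLimit a (suc k)))
    Λ₃-unitLower : UnitLowerTriangular n Λ₃
    Λ₃-unitLower = mul-scaledLowerToeplitz-unitLower n Λ₂ (a (suc k)) (cfLimit a (suc k)) Λ₂-unitLower refl (a²≡1 (suc k))

  hankel-IsStieltjesCF : ∀ f → IsStieltjesCF a f → ∀ n → hankel f n ≡ cfHankel a 0 n
  hankel-IsStieltjesCF f f-limit n = begin
    hankel f n                                                 ≡⟨ detℕ-cong n (λ i j i<n _ →
                                                                    trans (IsStieltjesCF⇒cfLimit a f f-limit (i ℕ.+ j))
                                                                          (sym (mul-identityˡ n (hankelMatrix (cfLimit a 0)) i j i<n))) ⟩
    detℕ n (mul n identity (hankelMatrix (cfLimit a 0)))       ≡⟨ detℕ-hankel-cfLimit n 0 identity (identity-unitLower n) ⟩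
    cfHankel a 0 n                                             ∎
    where open ≡-Reasoning

-- Two-automatic sequences

module _ {S : Set} (seq : S → Series) (step₀ step₁ : S → S)
         (step₀-even : ∀ q → (λ n → seq q (2 ℕ.* n)) ≗ seq (step₀ q))
         (step₁-odd : ∀ q → (λ n → seq q (2 ℕ.* n ℕ.+ 1)) ≗ seq (step₁ q)) where

  kernel-state : ∀ q d r → r < 2 ℕ.^ d → ∃ λ q′ → (λ n → seq q (2 ℕ.^ d ℕ.* n ℕ.+ r)) ≗ seq q′
  kernel-state q zero    zero    _ = q , λ n → cong (seq q) (trans (ℕₚ.+-identityʳ _) (ℕₚ.*-identityˡ n))
  kernel-state q zero    (suc r) (s≤s ())
  kernel-state q (suc d) r r<2^d+1 with r ℕ.<? 2 ℕ.^ d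
  ... | yes r<2^d =
    let q′ , q′≗ = kernel-state q d r r<2^d in
    step₀ q′ , λ n → trans (cong (seq q) (double (2 ℕ.^ d) n r)) (trans (q′≗ (2 ℕ.* n)) (step₀-even q′ n))
    where double : ∀ p n r → 2 ℕ.* p ℕ.* n ℕ.+ r ≡ p ℕ.* (2 ℕ.* n) ℕ.+ r
          double = ℕ-Ring.solve-∀
  ... | no r≮2^d with ℕₚ.m≤n⇒∃[o]m+o≡n (ℕₚ.≮⇒≥ r≮2^d)
  ...   | r′ , refl =
    let q′ , q′≗ = kernel-state q d r′ r′<2^d in
    step₁ q′ , λ n → trans (cong (seq q) (double+1 (2 ℕ.^ d) n r′)) (trans (q′≗ (2 ℕ.* n ℕ.+ 1)) (step₁-odd q′ n))
    where
    double+1 : ∀ p n r → 2 ℕ.* p ℕ.* n ℕ.+ (p ℕ.+ r) ≡ p ℕ.* (2 ℕ.* n ℕ.+ 1) ℕ.+ r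
    double+1 = ℕ-Ring.solve-∀
    twice : ∀ p → 2 ℕ.* p ≡ p ℕ.+ p
    twice = ℕ-Ring.solve-∀
    r′<2^d : r′ < 2 ℕ.^ d
    r′<2^d = ℕₚ.+-cancelˡ-< (2 ℕ.^ d) r′ (2 ℕ.^ d) (subst (2 ℕ.^ d ℕ.+ r′ <_) (twice (2 ℕ.^ d)) r<2^d+1)

  finiteAutomaton⇒2-automatic : (states : List S) → (∀ q → q ∈ states) → ∀ q → Is2Automatic (seq q)
  finiteAutomaton⇒2-automatic states complete q = List.map seq states , λ d r r<2^d →
    let q′ , q′≗ = kernel-state q d r r<2^d in
    Anyₚ.map⁺ (Any.map (λ { refl → q′≗ }) (complete q′))

data ParityView : ℕ → Set where
  even : ∀ m → ParityView (2 ℕ.* m)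
  odd  : ∀ m → ParityView (2 ℕ.* m ℕ.+ 1)

suc-double : ∀ m → suc (2 ℕ.* m) ≡ 2 ℕ.* m ℕ.+ 1
suc-double = ℕ-Ring.solve-∀

double-suc : ∀ m → 2 ℕ.* suc m ≡ suc (suc (2 ℕ.* m))
double-suc = ℕ-Ring.solve-∀

parityView : ∀ n → ParityView n
parityView zero = even 0
parityView (suc n) with parityView n
... | even m = subst ParityView (sym (suc-double m)) (odd m)
... | odd  m = subst ParityView (trans (double-suc m) (cong suc (suc-double m))) (even (suc m))

-1^-even : ∀ m → -1ℤ ^ (2 ℕ.* m) ≡ + 1
-1^-even zero    = refl
-1^-even (suc m) = begin
  -1ℤ ^ (2 ℕ.* suc m)           ≡⟨ cong (-1ℤ ^_) (double-suc m) ⟩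
  -1ℤ * (-1ℤ * -1ℤ ^ (2 ℕ.* m)) ≡⟨ ℤₚ.*-assoc -1ℤ -1ℤ _ ⟨
  + 1 * -1ℤ ^ (2 ℕ.* m)         ≡⟨ ℤₚ.*-identityˡ _ ⟩
  -1ℤ ^ (2 ℕ.* m)               ≡⟨ -1^-even m ⟩
  + 1                           ∎
  where open ≡-Reasoning

-1^-odd : ∀ m → -1ℤ ^ (2 ℕ.* m ℕ.+ 1) ≡ -1ℤ
-1^-odd m = trans (cong (-1ℤ ^_) (sym (suc-double m))) (cong (-1ℤ *_) (-1^-even m))

signSequence-square : ∀ (a : ℕ → ℤ) → a 0 ≡ + 1 → (∀ m → a (2 ℕ.* m) ≡ a m ⊎ a (2 ℕ.* m) ≡ + 1) →
  (∀ m → a (2 ℕ.* m ℕ.+ 1) ≡ - a m) → ∀ n → a n * a n ≡ + 1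
signSequence-square a a₀≡1 a-even a-odd = <-rec (λ n → a n * a n ≡ + 1) square
  where
  square : ∀ n → (∀ {m} → m < n → a m * a m ≡ + 1) → a n * a n ≡ + 1
  square n smaller with parityView n
  ... | even zero = cong₂ _*_ a₀≡1 a₀≡1
  ... | even (suc m) with a-even (suc m)
  ...   | inj₁ a₂ₘ≡aₘ = trans (cong₂ _*_ a₂ₘ≡aₘ a₂ₘ≡aₘ) (smaller (subst (suc m <_) (sym (double-suc m))
                          (s≤s (s≤s (ℕₚ.m≤n*m m 2)))))
  ...   | inj₂ a₂ₘ≡1  = cong₂ _*_ a₂ₘ≡1 a₂ₘ≡1
  square n smaller | odd m = begin
    a (2 ℕ.* m ℕ.+ 1) * a (2 ℕ.* m ℕ.+ 1) ≡⟨ cong₂ _*_ (a-odd m) (a-odd m) ⟩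
    (- a m) * (- a m)                     ≡⟨ neg*neg (a m) ⟩
    a m * a m                             ≡⟨ smaller (subst (m <_) (suc-double m) (s≤s (ℕₚ.m≤n*m m 2))) ⟩
    + 1                                   ∎
    where
    open ≡-Reasoning
    neg*neg : ∀ x → (- x) * (- x) ≡ x * x
    neg*neg = solve-∀

blockProduct : (ℕ → ℤ) → ℕ → ℕ → ℤ
blockProduct a k zero    = a k
blockProduct a k (suc n) = a k * a (suc k) * blockProduct a (suc (suc k)) n

cfHankel-suc : ∀ a n k → cfHankel a k (suc n) ≡ cfHankel a k n * blockProduct a k n
cfHankel-suc a zero    k = rearrange (a k)
  where rearrange : ∀ x → x * (+ 1 * (+ 1 * + 1)) ≡ + 1 * x
        rearrange = solve-∀
cfHankel-suc a (suc n) k =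
  trans (cong (λ h → a k * ((- a k) ^ suc n * ((- a (suc k)) ^ suc n * h))) (cfHankel-suc a n (suc (suc k))))
        (rearrange (a k) (a (suc k)) ((- a k) ^ n) ((- a (suc k)) ^ n) (cfHankel a (suc (suc k)) n) (blockProduct a (suc (suc k)) n))
  where rearrange : ∀ x y p q h r → x * ((- x) * p * ((- y) * q * (h * r))) ≡ x * (p * (q * h)) * (x * y * r)
        rearrange = solve-∀

-1^-square : ∀ m → -1ℤ ^ m * -1ℤ ^ m ≡ + 1
-1^-square zero    = refl
-1^-square (suc m) = trans (rearrange (-1ℤ ^ m)) (-1^-square m)
  where rearrange : ∀ p → -1ℤ * p * (-1ℤ * p) ≡ p * p
        rearrange = solve-∀

rangeProduct : (ℕ → ℤ) → ℕ → ℕ → ℤ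
rangeProduct a k zero    = + 1
rangeProduct a k (suc n) = a k * rangeProduct a (suc k) n

rangeProduct-last : ∀ a n k → rangeProduct a k (suc n) ≡ rangeProduct a k n * a (k ℕ.+ n)
rangeProduct-last a zero    k = trans (ℤₚ.*-comm (a k) (+ 1)) (cong (λ i → + 1 * a i) (sym (ℕₚ.+-identityʳ k)))
rangeProduct-last a (suc n) k = begin
  a k * rangeProduct a (suc k) (suc n)              ≡⟨ cong (a k *_) (rangeProduct-last a n (suc k)) ⟩
  a k * (rangeProduct a (suc k) n * a (suc k ℕ.+ n)) ≡⟨ ℤₚ.*-assoc (a k) _ _ ⟨
  a k * rangeProduct a (suc k) n * a (suc k ℕ.+ n)   ≡⟨ cong (λ i → a k * rangeProduct a (suc k) n * a i) (ℕₚ.+-suc k n) ⟨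
  a k * rangeProduct a (suc k) n * a (k ℕ.+ suc n)   ∎
  where open ≡-Reasoning

rangeProduct-square : ∀ a → (∀ k → a k * a k ≡ + 1) → ∀ n k → rangeProduct a k n * rangeProduct a k n ≡ + 1
rangeProduct-square a a² zero    k = refl
rangeProduct-square a a² (suc n) k = begin
  a k * p * (a k * p)     ≡⟨ rearrange (a k) p ⟩
  (a k * a k) * (p * p)   ≡⟨ cong₂ _*_ (a² k) (rangeProduct-square a a² n (suc k)) ⟩
  + 1                     ∎
  where
  open ≡-Reasoning
  p = rangeProduct a (suc k) n
  rearrange : ∀ x y → x * y * (x * y) ≡ (x * x) * (y * y)
  rearrange = solve-∀

module ThueMorse (t : ℕ → ℤ) (t-tm : IsThueMorse t) where

  t₀≡1 : t 0 ≡ + 1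
  t₀≡1 = proj₁ t-tm

  t-odd : ∀ n → t (2 ℕ.* n ℕ.+ 1) ≡ - t n
  t-odd = proj₂ (proj₂ t-tm)

  t-even : ∀ n → t (2 ℕ.* n) ≡ t n
  t-even zero    = refl
  t-even (suc n) = proj₁ (proj₂ t-tm) (suc n) (s≤s z≤n)

  t² : ∀ n → t n * t n ≡ + 1
  t² = signSequence-square t t₀≡1 (inj₁ ∘ t-even) t-odd

  blockProduct-t : ∀ n k → blockProduct t (2 ℕ.* k) n ≡ -1ℤ ^ n * t (k ℕ.+ n)
  blockProduct-t zero    k = trans (t-even k) (sym (trans (ℤₚ.*-identityˡ _) (cong t (ℕₚ.+-identityʳ k))))
  blockProduct-t (suc n) k = begin
    t (2 ℕ.* k) * t (suc (2 ℕ.* k)) * blockProduct t (suc (suc (2 ℕ.* k))) n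
      ≡⟨ cong₂ (λ x y → t (2 ℕ.* k) * x * y) (trans (cong t (suc-double k)) (t-odd k))
           (trans (cong (λ x → blockProduct t x n) (sym (double-suc k))) (blockProduct-t n (suc k))) ⟩
    t (2 ℕ.* k) * (- t k) * (-1ℤ ^ n * t (suc k ℕ.+ n))
      ≡⟨ cong (λ x → x * (- t k) * (-1ℤ ^ n * t (suc k ℕ.+ n))) (t-even k) ⟩
    t k * (- t k) * (-1ℤ ^ n * t (suc k ℕ.+ n))
      ≡⟨ rearrange (t k) (-1ℤ ^ n) (t (suc k ℕ.+ n)) ⟩
    - (t k * t k) * -1ℤ ^ n * t (suc k ℕ.+ n)
      ≡⟨ cong₂ (λ x y → - x * -1ℤ ^ n * t y) (t² k) (sym (ℕₚ.+-suc k n)) ⟩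
    -1ℤ ^ suc n * t (k ℕ.+ suc n) ∎
    where
    open ≡-Reasoning
    rearrange : ∀ x p y → x * (- x) * (p * y) ≡ - (x * x) * p * y
    rearrange = solve-∀

  module _ (C : Series) (C-cf : IsStieltjesCF t C) where

    hankel-suc : ∀ n → hankel C (suc n) ≡ hankel C n * (-1ℤ ^ n * t n)
    hankel-suc n = begin
      hankel C (suc n)                   ≡⟨ hankel-IsStieltjesCF t t² C C-cf (suc n) ⟩
      cfHankel t 0 (suc n)               ≡⟨ cfHankel-suc t n 0 ⟩
      cfHankel t 0 n * blockProduct t 0 n ≡⟨ cong₂ _*_ (sym (hankel-IsStieltjesCF t t² C C-cf n)) (blockProduct-t n 0) ⟩
      hankel C n * (-1ℤ ^ n * t n)       ∎
      where open ≡-Reasoning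

    hankel-even : ∀ m → hankel C (2 ℕ.* m) ≡ + 1
    hankel-odd  : ∀ m → hankel C (2 ℕ.* m ℕ.+ 1) ≡ t m
    hankel-odd m = begin
      hankel C (2 ℕ.* m ℕ.+ 1)                          ≡⟨ cong (hankel C) (suc-double m) ⟨
      hankel C (suc (2 ℕ.* m))                          ≡⟨ hankel-suc (2 ℕ.* m) ⟩
      hankel C (2 ℕ.* m) * (-1ℤ ^ (2 ℕ.* m) * t (2 ℕ.* m)) ≡⟨ cong₂ (λ h p → h * (p * t (2 ℕ.* m))) (hankel-even m) (-1^-even m) ⟩
      + 1 * (+ 1 * t (2 ℕ.* m))                         ≡⟨ trans (ℤₚ.*-identityˡ _) (ℤₚ.*-identityˡ _) ⟩
      t (2 ℕ.* m)                                       ≡⟨ t-even m ⟩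
      t m                                               ∎
      where open ≡-Reasoning
    hankel-even zero    = refl
    hankel-even (suc m) = begin
      hankel C (2 ℕ.* suc m)                            ≡⟨ cong (hankel C) (trans (double-suc m) (cong suc (suc-double m))) ⟩
      hankel C (suc (2 ℕ.* m ℕ.+ 1))                    ≡⟨ hankel-suc (2 ℕ.* m ℕ.+ 1) ⟩
      hankel C (2 ℕ.* m ℕ.+ 1) * (-1ℤ ^ (2 ℕ.* m ℕ.+ 1) * t (2 ℕ.* m ℕ.+ 1))
                                                        ≡⟨ cong₂ (λ h x → h * x) (hankel-odd m) (cong₂ _*_ (-1^-odd m) (t-odd m)) ⟩
      t m * (-1ℤ * (- t m))                             ≡⟨ rearrange (t m) ⟩
      t m * t m                                         ≡⟨ t² m ⟩
      + 1                                               ∎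
      where
      open ≡-Reasoning
      rearrange : ∀ x → x * (-1ℤ * (- x)) ≡ x * x
      rearrange = solve-∀

    data State : Set where
      hankelC one tm negTm : State

    states : List State
    states = hankelC ∷ one ∷ tm ∷ negTm ∷ []

    states-complete : ∀ q → q ∈ states
    states-complete hankelC = Any.here refl
    states-complete one     = Any.there (Any.here refl)
    states-complete tm      = Any.there (Any.there (Any.here refl))
    states-complete negTm   = Any.there (Any.there (Any.there (Any.here refl)))

    seqOf : State → Series
    seqOf hankelC = hankel C
    seqOf one     = λ _ → + 1
    seqOf tm      = t
    seqOf negTm   = λ n → - t n

    step₀ step₁ : State → State
    step₀ hankelC = one
    step₀ one     = one
    step₀ tm      = tm
    step₀ negTm   = negTm
    step₁ hankelC = tm
    step₁ one     = one
    step₁ tm      = negTm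
    step₁ negTm   = tm

    step₀-even : ∀ q → (λ n → seqOf q (2 ℕ.* n)) ≗ seqOf (step₀ q)
    step₀-even hankelC = hankel-even
    step₀-even one     = λ _ → refl
    step₀-even tm      = t-even
    step₀-even negTm   = cong -_ ∘ t-even

    step₁-odd : ∀ q → (λ n → seqOf q (2 ℕ.* n ℕ.+ 1)) ≗ seqOf (step₁ q)
    step₁-odd hankelC = hankel-odd
    step₁-odd one     = λ _ → refl
    step₁-odd tm      = t-odd
    step₁-odd negTm   = λ n → trans (cong -_ (t-odd n)) (ℤₚ.neg-involutive (t n))

    hankel-2-automatic : Is2Automatic (hankel C)
    hankel-2-automatic = finiteAutomaton⇒2-automatic seqOf step₀ step₁ step₀-even step₁-odd states states-complete hankelC

module PeriodDoubling (s : ℕ → ℤ) (s-pd : IsPeriodDoubling s) where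

  s-even : ∀ n → s (2 ℕ.* n) ≡ + 1
  s-even = proj₁ s-pd

  s-odd : ∀ n → s (2 ℕ.* n ℕ.+ 1) ≡ - s n
  s-odd = proj₂ s-pd

  s² : ∀ n → s n * s n ≡ + 1
  s² = signSequence-square s (s-even 0) (inj₂ ∘ s-even) s-odd

  s-suc-double : ∀ k → s (suc (2 ℕ.* k)) ≡ - s k
  s-suc-double k = trans (cong s (suc-double k)) (s-odd k)

  blockProduct-s : ∀ n k → blockProduct s (2 ℕ.* k) n ≡ -1ℤ ^ n * rangeProduct s k n
  blockProduct-s zero    k = s-even k
  blockProduct-s (suc n) k = begin
    s (2 ℕ.* k) * s (suc (2 ℕ.* k)) * blockProduct s (suc (suc (2 ℕ.* k))) n
      ≡⟨ cong₂ (λ x y → x * y) (cong₂ _*_ (s-even k) (s-suc-double k))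
           (trans (cong (λ x → blockProduct s x n) (sym (double-suc k))) (blockProduct-s n (suc k))) ⟩
    + 1 * (- s k) * (-1ℤ ^ n * rangeProduct s (suc k) n)
      ≡⟨ rearrange (s k) (-1ℤ ^ n) (rangeProduct s (suc k) n) ⟩
    -1ℤ ^ suc n * rangeProduct s k (suc n) ∎
    where
    open ≡-Reasoning
    rearrange : ∀ x p r → + 1 * (- x) * (p * r) ≡ -1ℤ * p * (x * r)
    rearrange = solve-∀

  rangeProduct-double : ∀ n k → rangeProduct s (2 ℕ.* k) (2 ℕ.* n) ≡ -1ℤ ^ n * rangeProduct s k n
  rangeProduct-double zero    k = refl
  rangeProduct-double (suc n) k = begin
    rangeProduct s (2 ℕ.* k) (2 ℕ.* suc n)
      ≡⟨ cong (rangeProduct s (2 ℕ.* k)) (double-suc n) ⟩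
    s (2 ℕ.* k) * (s (suc (2 ℕ.* k)) * rangeProduct s (suc (suc (2 ℕ.* k))) (2 ℕ.* n))
      ≡⟨ cong₂ (λ x y → x * y) (s-even k) (cong₂ _*_ (s-suc-double k)
           (trans (cong (λ x → rangeProduct s x (2 ℕ.* n)) (sym (double-suc k))) (rangeProduct-double n (suc k)))) ⟩
    + 1 * ((- s k) * (-1ℤ ^ n * rangeProduct s (suc k) n))
      ≡⟨ rearrange (s k) (-1ℤ ^ n) (rangeProduct s (suc k) n) ⟩
    -1ℤ ^ suc n * rangeProduct s k (suc n) ∎
    where
    open ≡-Reasoning
    rearrange : ∀ x p r → + 1 * ((- x) * (p * r)) ≡ -1ℤ * p * (x * r)
    rearrange = solve-∀

  R : Series
  R = rangeProduct s 0

  R-double : ∀ n → R (2 ℕ.* n) ≡ -1ℤ ^ n * R n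
  R-double n = rangeProduct-double n 0

  R-suc-double : ∀ n → R (2 ℕ.* n ℕ.+ 1) ≡ R (2 ℕ.* n)
  R-suc-double n = begin
    R (2 ℕ.* n ℕ.+ 1)           ≡⟨ cong R (suc-double n) ⟨
    R (suc (2 ℕ.* n))           ≡⟨ rangeProduct-last s (2 ℕ.* n) 0 ⟩
    R (2 ℕ.* n) * s (2 ℕ.* n)   ≡⟨ cong (R (2 ℕ.* n) *_) (s-even n) ⟩
    R (2 ℕ.* n) * + 1           ≡⟨ ℤₚ.*-identityʳ _ ⟩
    R (2 ℕ.* n)                 ∎
    where open ≡-Reasoning

  module _ (D : Series) (D-cf : IsStieltjesCF s D) where

    hankel-suc : ∀ n → hankel D (suc n) ≡ hankel D n * (-1ℤ ^ n * R n)
    hankel-suc n = begin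
      hankel D (suc n)                    ≡⟨ hankel-IsStieltjesCF s s² D D-cf (suc n) ⟩
      cfHankel s 0 (suc n)                ≡⟨ cfHankel-suc s n 0 ⟩
      cfHankel s 0 n * blockProduct s 0 n ≡⟨ cong₂ _*_ (sym (hankel-IsStieltjesCF s s² D D-cf n)) (blockProduct-s n 0) ⟩
      hankel D n * (-1ℤ ^ n * R n)        ∎
      where open ≡-Reasoning

    hankel-even : ∀ m → hankel D (2 ℕ.* m) ≡ -1ℤ ^ m
    hankel-odd  : ∀ m → hankel D (2 ℕ.* m ℕ.+ 1) ≡ R m
    hankel-odd m = begin
      hankel D (2 ℕ.* m ℕ.+ 1)                              ≡⟨ cong (hankel D) (suc-double m) ⟨
      hankel D (suc (2 ℕ.* m))                              ≡⟨ hankel-suc (2 ℕ.* m) ⟩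
      hankel D (2 ℕ.* m) * (-1ℤ ^ (2 ℕ.* m) * R (2 ℕ.* m))  ≡⟨ cong₂ (λ h p → h * (p * R (2 ℕ.* m))) (hankel-even m) (-1^-even m) ⟩
      -1ℤ ^ m * (+ 1 * R (2 ℕ.* m))                         ≡⟨ cong (λ x → -1ℤ ^ m * x) (trans (ℤₚ.*-identityˡ _) (R-double m)) ⟩
      -1ℤ ^ m * (-1ℤ ^ m * R m)                             ≡⟨ ℤₚ.*-assoc (-1ℤ ^ m) _ _ ⟨
      -1ℤ ^ m * -1ℤ ^ m * R m                               ≡⟨ cong (_* R m) (-1^-square m) ⟩
      + 1 * R m                                             ≡⟨ ℤₚ.*-identityˡ (R m) ⟩
      R m                                                   ∎
      where open ≡-Reasoning
    hankel-even zero    = refl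
    hankel-even (suc m) = begin
      hankel D (2 ℕ.* suc m)                               ≡⟨ cong (hankel D) (trans (double-suc m) (cong suc (suc-double m))) ⟩
      hankel D (suc (2 ℕ.* m ℕ.+ 1))                       ≡⟨ hankel-suc (2 ℕ.* m ℕ.+ 1) ⟩
      hankel D (2 ℕ.* m ℕ.+ 1) * (-1ℤ ^ (2 ℕ.* m ℕ.+ 1) * R (2 ℕ.* m ℕ.+ 1))
                                                           ≡⟨ cong₂ (λ h x → h * x) (hankel-odd m)
                                                                (cong₂ _*_ (-1^-odd m) (trans (R-suc-double m) (R-double m))) ⟩
      R m * (-1ℤ * (-1ℤ ^ m * R m))                        ≡⟨ rearrange (R m) (-1ℤ ^ m) ⟩
      -1ℤ ^ suc m * (R m * R m)                            ≡⟨ cong (-1ℤ ^ suc m *_) (rangeProduct-square s s² m 0) ⟩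
      -1ℤ ^ suc m * + 1                                    ≡⟨ ℤₚ.*-identityʳ _ ⟩
      -1ℤ ^ suc m                                          ∎
      where
      open ≡-Reasoning
      rearrange : ∀ r p → r * (-1ℤ * (p * r)) ≡ -1ℤ * p * (r * r)
      rearrange = solve-∀

    R₂ : Series
    R₂ n = R (2 ℕ.* n)

    R₂-even : ∀ n → R₂ (2 ℕ.* n) ≡ R₂ n
    R₂-even n = begin
      R (2 ℕ.* (2 ℕ.* n))                 ≡⟨ R-double (2 ℕ.* n) ⟩
      -1ℤ ^ (2 ℕ.* n) * R (2 ℕ.* n)       ≡⟨ cong (_* R (2 ℕ.* n)) (-1^-even n) ⟩
      + 1 * R (2 ℕ.* n)                   ≡⟨ ℤₚ.*-identityˡ _ ⟩
      R (2 ℕ.* n)                         ∎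
      where open ≡-Reasoning

    R₂-odd : ∀ n → R₂ (2 ℕ.* n ℕ.+ 1) ≡ - R₂ n
    R₂-odd n = begin
      R (2 ℕ.* (2 ℕ.* n ℕ.+ 1))                     ≡⟨ R-double (2 ℕ.* n ℕ.+ 1) ⟩
      -1ℤ ^ (2 ℕ.* n ℕ.+ 1) * R (2 ℕ.* n ℕ.+ 1)     ≡⟨ cong₂ _*_ (-1^-odd n) (R-suc-double n) ⟩
      -1ℤ * R (2 ℕ.* n)                             ≡⟨ ℤₚ.-1*i≡-i _ ⟩
      - R (2 ℕ.* n)                                 ∎
      where open ≡-Reasoning

    data State : Set where
      hankelD alternating one minusOne r r₂ negR₂ : State

    states : List State
    states = hankelD ∷ alternating ∷ one ∷ minusOne ∷ r ∷ r₂ ∷ negR₂ ∷ []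

    states-complete : ∀ q → q ∈ states
    states-complete hankelD     = Any.here refl
    states-complete alternating = Any.there (Any.here refl)
    states-complete one         = Any.there (Any.there (Any.here refl))
    states-complete minusOne    = Any.there (Any.there (Any.there (Any.here refl)))
    states-complete r           = Any.there (Any.there (Any.there (Any.there (Any.here refl))))
    states-complete r₂          = Any.there (Any.there (Any.there (Any.there (Any.there (Any.here refl)))))
    states-complete negR₂       = Any.there (Any.there (Any.there (Any.there (Any.there (Any.there (Any.here refl))))))

    seqOf : State → Series
    seqOf hankelD     = hankel D
    seqOf alternating = -1ℤ ^_
    seqOf one         = λ _ → + 1
    seqOf minusOne    = λ _ → -1ℤ
    seqOf r           = R
    seqOf r₂          = R₂
    seqOf negR₂       = λ n → - R₂ n

    step₀ step₁ : State → State
    step₀ hankelD     = alternating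
    step₀ alternating = one
    step₀ one         = one
    step₀ minusOne    = minusOne
    step₀ r           = r₂
    step₀ r₂          = r₂
    step₀ negR₂       = negR₂
    step₁ hankelD     = r
    step₁ alternating = minusOne
    step₁ one         = one
    step₁ minusOne    = minusOne
    step₁ r           = r₂
    step₁ r₂          = negR₂
    step₁ negR₂       = r₂

    step₀-even : ∀ q → (λ n → seqOf q (2 ℕ.* n)) ≗ seqOf (step₀ q)
    step₀-even hankelD     = hankel-even
    step₀-even alternating = -1^-even
    step₀-even one         = λ _ → refl
    step₀-even minusOne    = λ _ → refl
    step₀-even r           = λ _ → refl
    step₀-even r₂          = R₂-even
    step₀-even negR₂       = cong -_ ∘ R₂-even

    step₁-odd : ∀ q → (λ n → seqOf q (2 ℕ.* n ℕ.+ 1)) ≗ seqOf (step₁ q)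
    step₁-odd hankelD     = hankel-odd
    step₁-odd alternating = -1^-odd
    step₁-odd one         = λ _ → refl
    step₁-odd minusOne    = λ _ → refl
    step₁-odd r           = R-suc-double
    step₁-odd r₂          = R₂-odd
    step₁-odd negR₂       = λ n → trans (cong -_ (R₂-odd n)) (ℤₚ.neg-involutive (R₂ n))

    hankel-2-automatic : Is2Automatic (hankel D)
    hankel-2-automatic = finiteAutomaton⇒2-automatic seqOf step₀ step₁ step₀-even step₁-odd states states-complete hankelD

theorem1p8 :
    (∀ (t : ℕ → ℤ) → IsThueMorse t → ∀ (C : Series) → IsStieltjesCF t C →
       Is2Automatic (hankel C)) ×
    (∀ (s : ℕ → ℤ) → IsPeriodDoubling s → ∀ (D : Series) → IsStieltjesCF s D →
       Is2Automatic (hankel D))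
theorem1p8 = (λ t t-tm C C-cf → ThueMorse.hankel-2-automatic t t-tm C C-cf)
           , (λ s s-pd D D-cf → PeriodDoubling.hankel-2-automatic s s-pd D D-cf)
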